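{- For $n$ even with $n\ge4$, \[\operatorname{gon}(H_{3,n})=\begin{cases}3,& n\le 6,\\ 4,& n\ge 8.\end{cases}\]
   Context: For $n\ge4$ even, the Harary graph $H_{3,n}$ is the circulant graph $\mathrm{Ci}_n(\{1,n/2\})$: vertices $v_1,\ldots,v_n$ arranged in a cycle, with $v_i$ adjacent to $v_m$ iff $|i-m|\bmod n\in\{1,n/2\}$. For a connected loopless multigraph $G$: a divisor is a function $D:V(G)\to\mathbb{Z}$; effective if all values are $\ge0$; degree $\sum_vD(v)$. Firing a vertex $v$ moves one chip from $v$ along each incident edge; divisors are equivalent if related by a sequence of firings. $D$ has positive rank if for every vertex $q$, $D-q$ is equivalent to an effective divisor. $\operatorname{gon}(G)$ is the minimum degree of a positive rank divisor. -}

module Defs where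

open import Data.Nat as ℕ using (ℕ; zero; suc; ∣_-_∣; ⌊_/2⌋; _∸_)
open import Data.Fin using (Fin; toℕ)
import Data.Fin as Fin
open import Data.Integer as ℤ using (ℤ; +_; _+_; _-_; _≥_; _≤_)
open import Data.Product using (Σ; ∃; _×_; _,_)
open import Data.Sum using (_⊎_)
open import Relation.Nullary using (yes; no)
open import Relation.Nullary.Decidable using (_⊎-dec_)
open import Relation.Binary.PropositionalEquality using (_≡_)
open import Relation.Binary.Construct.Closure.Equivalence using (EqClosure)

-- A multigraph on vertex set Fin n is given by its edge-multiplicity
-- function (G v w = number of edges between v and w).  The only graphs
-- used below (Harary graphs with n >= 4) are symmetric and loopless.
Multigraph : ℕ → Set
Multigraph n = Fin n → Fin n → ℕ

mult : {n : ℕ} → Multigraph n → Fin n → Fin n → ℕ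
mult G = G

sumFin : {n : ℕ} → (Fin n → ℤ) → ℤ
sumFin {zero}  f = + 0
sumFin {suc n} f = f Fin.zero + sumFin (λ i → f (Fin.suc i))

Divisor : ℕ → Set
Divisor n = Fin n → ℤ

Effective : {n : ℕ} → Divisor n → Set
Effective D = ∀ v → D v ≥ + 0

deg : {n : ℕ} → Divisor n → ℤ
deg D = sumFin D

valence : {n : ℕ} → Multigraph n → Fin n → ℤ
valence G v = sumFin (λ w → + mult G v w)

fire : {n : ℕ} → Multigraph n → Fin n → Divisor n → Divisor n
fire G v D w with v Fin.≟ w
... | yes _ = D w - valence G v
... | no  _ = D w + (+ mult G v w)

FireStep : {n : ℕ} → Multigraph n → Divisor n → Divisor n → Set
FireStep G D E = ∃ λ v → ∀ w → E w ≡ fire G v D w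

Equiv : {n : ℕ} → Multigraph n → Divisor n → Divisor n → Set
Equiv G = EqClosure (FireStep G)

minusPt : {n : ℕ} → Divisor n → Fin n → Divisor n
minusPt D q w with q Fin.≟ w
... | yes _ = D w - + 1
... | no  _ = D w

PositiveRank : {n : ℕ} → Multigraph n → Divisor n → Set
PositiveRank G D = ∀ q → ∃ λ E → Effective E × Equiv G (minusPt D q) E

IsGonality : {n : ℕ} → Multigraph n → ℤ → Set
IsGonality G g =
  (∃ λ D → PositiveRank G D × deg D ≡ g) ×
  (∀ D → PositiveRank G D → g ≤ deg D)

-- Harary graph H_{3,n} = Ci_n({1, n/2}), vertices indexed 0..n-1:
-- i ~ m iff the cyclic distance is 1 or n/2, i.e. |i-m| ∈ {1, n-1, n/2}.
HararyAdj : (n : ℕ) → Multigraph n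
HararyAdj n i m with (d ℕ.≟ 1) ⊎-dec ((d ℕ.≟ n ∸ 1) ⊎-dec (d ℕ.≟ ⌊ n /2⌋))
  where d = ∣ toℕ i - toℕ m ∣
... | yes _ = 1
... | no  _ = 0

module Submission where

-- Linear equivalence is E = D − Δf for an integer script f (Δ the graph Laplacian).  If an effective
-- D₀ of positive rank has no chip at q, a script g moving a chip onto q is non-constant, and the
-- level set U = {g ≥ max g} has cut(U) ≤ Σ_U Δg ≤ deg D₀; if D₀ has a chip everywhere, deg D₀ ≥ n.
-- H_{3,n} is 3-edge-connected, giving gon ≥ 3.  For n ≥ 8 a cut of size 3 only isolates a vertex,
-- which pins a degree-3 D₀ down to three chips on one vertex x or to chips on every neighbour of q.
-- Taking q at distance 2 from x, resp. q such that neither q nor its opposite vertex carries a chip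
-- (otherwise each of the k ≥ 4 opposite pairs does), rules out degree 3.  Conversely three chips on
-- a vertex have positive rank on K₄ and K_{3,3}, and for n ≥ 8 two chips on both ends of one rung of
-- the Möbius ladder reach every vertex by scripts that are constant on rungs and tent-shaped along
-- the rung cycle.

module Laplacian where

  open import Defs
  open import Data.Nat as ℕ using (zero; suc)
  open import Data.Fin as Fin using (Fin; _↑ˡ_; _↑ʳ_) renaming (zero to fz; suc to fs)
  import Data.Fin.Properties as FinP
  open import Data.Integer as ℤ using (ℤ; +_; -[1+_]; _+_; _-_; -_; _*_; _≤_; _<_; _≥_; +≤+)
  import Data.Integer.Properties as ℤP
  open import Data.Integer.Solver using (module +-*-Solver)
  open +-*-Solver
  open import Data.Bool using (Bool; true; false; if_then_else_; not; _∧_; _∨_)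
  import Data.Bool.Properties as BoolP
  open import Data.Product using (∃; _,_)
  open import Data.Empty using (⊥-elim)
  open import Function using (_∘_)
  open import Relation.Nullary using (yes; no; does)
  open import Relation.Nullary.Decidable using (dec-true; dec-false)
  open import Relation.Binary.PropositionalEquality
  open import Relation.Binary.Construct.Closure.ReflexiveTransitive using (ε; _◅_; _◅◅_)
  open import Relation.Binary.Construct.Closure.Symmetric using (fwd; bwd)
  open import Relation.Binary.Construct.Closure.Equivalence using (symmetric; fold)
  open import Relation.Binary.Structures using (IsEquivalence)

  sumFin-cong : ∀ {n} {f g : Fin n → ℤ} → f ≗ g → sumFin f ≡ sumFin g
  sumFin-cong {zero}  f≗g = refl
  sumFin-cong {suc n} f≗g = cong₂ _+_ (f≗g fz) (sumFin-cong (f≗g ∘ fs))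

  sumFin-+ : ∀ {n} (f g : Fin n → ℤ) → sumFin (λ v → f v + g v) ≡ sumFin f + sumFin g
  sumFin-+ {zero}  f g = refl
  sumFin-+ {suc n} f g = begin
    (f fz + g fz) + sumFin (λ v → f (fs v) + g (fs v))   ≡⟨ cong (_+_ (f fz + g fz)) (sumFin-+ (f ∘ fs) (g ∘ fs)) ⟩
    (f fz + g fz) + (sumFin (f ∘ fs) + sumFin (g ∘ fs))  ≡⟨ solve 4 (λ a b c d → (a :+ b) :+ (c :+ d) := (a :+ c) :+ (b :+ d)) refl
                                                              (f fz) (g fz) (sumFin (f ∘ fs)) (sumFin (g ∘ fs)) ⟩
    (f fz + sumFin (f ∘ fs)) + (g fz + sumFin (g ∘ fs))  ∎
    where open ≡-Reasoning

  sumFin-zero : ∀ n → sumFin {n} (λ _ → + 0) ≡ + 0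
  sumFin-zero zero    = refl
  sumFin-zero (suc n) = trans (ℤP.+-identityˡ _) (sumFin-zero n)

  sumFin-neg : ∀ {n} (f : Fin n → ℤ) → sumFin (λ v → - f v) ≡ - sumFin f
  sumFin-neg {zero}  f = refl
  sumFin-neg {suc n} f = trans (cong (_+_ (- f fz)) (sumFin-neg (f ∘ fs))) (sym (ℤP.neg-distrib-+ (f fz) _))

  sumFin-sub : ∀ {n} (f g : Fin n → ℤ) → sumFin (λ v → f v - g v) ≡ sumFin f - sumFin g
  sumFin-sub f g = trans (sumFin-+ f (λ v → - g v)) (cong (_+_ (sumFin f)) (sumFin-neg g))

  sumFin-*ˡ : ∀ {n} c (f : Fin n → ℤ) → sumFin (λ v → c * f v) ≡ c * sumFin f
  sumFin-*ˡ {zero}  c f = sym (ℤP.*-zeroʳ c)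
  sumFin-*ˡ {suc n} c f = trans (cong (_+_ (c * f fz)) (sumFin-*ˡ c (f ∘ fs))) (sym (ℤP.*-distribˡ-+ c (f fz) _))

  sumFin-mono : ∀ {n} {f g : Fin n → ℤ} → (∀ v → f v ≤ g v) → sumFin f ≤ sumFin g
  sumFin-mono {zero}  f≤g = ℤP.≤-refl
  sumFin-mono {suc n} f≤g = ℤP.+-mono-≤ (f≤g fz) (sumFin-mono (f≤g ∘ fs))

  sumFin-swap : ∀ {n m} (h : Fin n → Fin m → ℤ) →
                sumFin (λ v → sumFin (h v)) ≡ sumFin (λ w → sumFin (λ v → h v w))
  sumFin-swap {zero}  {m} h = sym (sumFin-zero m)
  sumFin-swap {suc n} {m} h = trans (cong (_+_ (sumFin (h fz))) (sumFin-swap (h ∘ fs)))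
                                    (sym (sumFin-+ (h fz) (λ w → sumFin (λ v → h (fs v) w))))

  sumFin-nonneg : ∀ {n} {f : Fin n → ℤ} → (∀ v → f v ≥ + 0) → sumFin f ≥ + 0
  sumFin-nonneg {n} {f} f≥0 = subst (_≤ sumFin f) (sumFin-zero n) (sumFin-mono f≥0)

  n≤sumFin : ∀ {n} {f : Fin n → ℤ} → (∀ v → + 1 ≤ f v) → + n ≤ sumFin f
  n≤sumFin {zero}  f≥1 = ℤP.≤-refl
  n≤sumFin {suc n} f≥1 = ℤP.+-mono-≤ (f≥1 fz) (n≤sumFin (f≥1 ∘ fs))

  term≤sumFin : ∀ {n} {f : Fin n → ℤ} → (∀ v → f v ≥ + 0) → ∀ v → f v ≤ sumFin f
  term≤sumFin {suc n} {f} f≥0 fz     = ℤP.i≤i+j (f fz) _ {{ℤ.nonNegative (sumFin-nonneg (f≥0 ∘ fs))}}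
  term≤sumFin {suc n} {f} f≥0 (fs v) =
    ℤP.≤-trans (term≤sumFin (f≥0 ∘ fs) v) (ℤP.i≤j+i _ (f fz) {{ℤ.nonNegative (f≥0 fz)}})

  sumFin-antisymmetric : ∀ {n} (a : Fin n → Fin n → ℤ) → (∀ v w → a w v ≡ - a v w) →
                         sumFin (λ v → sumFin (a v)) ≡ + 0
  sumFin-antisymmetric a anti = self-neg (begin
    sumFin (λ v → sumFin (a v))                ≡⟨ sumFin-swap a ⟩
    sumFin (λ w → sumFin (λ v → a v w))        ≡⟨ sumFin-cong (λ w → trans (sumFin-cong (anti w)) (sumFin-neg (a w))) ⟩
    sumFin (λ w → - sumFin (a w))              ≡⟨ sumFin-neg (λ w → sumFin (a w)) ⟩
    - sumFin (λ v → sumFin (a v))              ∎)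
    where
    open ≡-Reasoning
    self-neg : ∀ {x : ℤ} → x ≡ - x → x ≡ + 0
    self-neg {+ zero} _ = refl

  χ : ∀ {n} → Fin n → Fin n → ℤ
  χ a w = if does (a FinP.≟ w) then + 1 else + 0

  χ-same : ∀ {n} (a : Fin n) → χ a a ≡ + 1
  χ-same a = cong (λ b → if b then + 1 else + 0) (dec-true (a FinP.≟ a) refl)

  χ-diff : ∀ {n} {a w : Fin n} → a ≢ w → χ a w ≡ + 0
  χ-diff {a = a} {w} a≢w = cong (λ b → if b then + 1 else + 0) (dec-false (a FinP.≟ w) a≢w)

  χ-nonneg : ∀ {n} (a w : Fin n) → χ a w ≥ + 0
  χ-nonneg a w with does (a FinP.≟ w)
  ... | true  = +≤+ ℕ.z≤n
  ... | false = +≤+ ℕ.z≤n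

  sumFin-*χ : ∀ {n} (h : Fin n → ℤ) (a : Fin n) → sumFin (λ u → h u * χ a u) ≡ h a
  sumFin-*χ {suc n} h fz     = begin
    h fz * + 1 + sumFin (λ u → h (fs u) * + 0)  ≡⟨ cong₂ _+_ (ℤP.*-identityʳ (h fz))
                                                     (trans (sumFin-cong (λ u → ℤP.*-zeroʳ (h (fs u)))) (sumFin-zero n)) ⟩
    h fz + + 0                                  ≡⟨ ℤP.+-identityʳ (h fz) ⟩
    h fz                                        ∎
    where open ≡-Reasoning
  sumFin-*χ {suc n} h (fs a) = trans (cong₂ _+_ (ℤP.*-zeroʳ (h fz)) (sumFin-*χ (h ∘ fs) a)) (ℤP.+-identityˡ _)

  *χ-expand : ∀ {n} (h : Fin n → ℤ) (x v : Fin n) → (v ≢ x → h v ≡ + 0) → h v ≡ h x * χ x v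
  *χ-expand h x v h0 with x FinP.≟ v
  ... | yes refl = sym (ℤP.*-identityʳ (h x))
  ... | no x≢v   = trans (h0 (x≢v ∘ sym)) (sym (ℤP.*-zeroʳ (h x)))

  sumFin-supported₁ : ∀ {n} (h : Fin n → ℤ) x → (∀ v → v ≢ x → h v ≡ + 0) → sumFin h ≡ h x
  sumFin-supported₁ h x h0 = trans (sumFin-cong (λ v → *χ-expand h x v (h0 v))) (sumFin-*χ (λ _ → h x) x)

  sumFin-supported₂ : ∀ {n} (h : Fin n → ℤ) x y → x ≢ y → (∀ v → v ≢ x → v ≢ y → h v ≡ + 0) →
                      sumFin h ≡ h x + h y
  sumFin-supported₂ h x y x≢y h0 = begin
    sumFin h                                            ≡⟨ sumFin-cong split ⟩
    sumFin (λ v → h x * χ x v + h y * χ y v)            ≡⟨ sumFin-+ (λ v → h x * χ x v) (λ v → h y * χ y v) ⟩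
    sumFin (λ v → h x * χ x v) + sumFin (λ v → h y * χ y v)
                                                        ≡⟨ cong₂ _+_ (sumFin-*χ (λ _ → h x) x) (sumFin-*χ (λ _ → h y) y) ⟩
    h x + h y                                           ∎
    where
    open ≡-Reasoning
    split : ∀ v → h v ≡ h x * χ x v + h y * χ y v
    split v with x FinP.≟ v | y FinP.≟ v
    ... | yes refl | yes refl = ⊥-elim (x≢y refl)
    ... | yes refl | no _     = sym (trans (cong (_+_ (h x * + 1)) (ℤP.*-zeroʳ (h y)))
                                           (trans (ℤP.+-identityʳ _) (ℤP.*-identityʳ (h x))))
    ... | no _     | yes refl = sym (trans (cong (_+ h y * + 1) (ℤP.*-zeroʳ (h x)))
                                           (trans (ℤP.+-identityˡ _) (ℤP.*-identityʳ (h y))))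
    ... | no x≢v   | no y≢v   = trans (h0 v (x≢v ∘ sym) (y≢v ∘ sym))
                                      (sym (cong₂ _+_ (ℤP.*-zeroʳ (h x)) (ℤP.*-zeroʳ (h y))))

  sumFin-↑ : ∀ m {n} (f : Fin (m ℕ.+ n) → ℤ) → sumFin f ≡ sumFin (λ i → f (i ↑ˡ n)) + sumFin (λ j → f (m ↑ʳ j))
  sumFin-↑ zero    f = sym (ℤP.+-identityˡ (sumFin f))
  sumFin-↑ (suc m) {n} f = trans (cong (_+_ (f fz)) (sumFin-↑ m (f ∘ fs)))
                                 (sym (ℤP.+-assoc (f fz) (sumFin (λ i → f (fs (i ↑ˡ n)))) (sumFin (λ j → f (fs (m ↑ʳ j))))))

  sumOver : ∀ {n} → (Fin n → Bool) → (Fin n → ℤ) → ℤ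
  sumOver U f = sumFin (λ v → if U v then f v else + 0)

  restrict-split : ∀ b (x : ℤ) → (if b then x else + 0) + (if not b then x else + 0) ≡ x
  restrict-split true  x = ℤP.+-identityʳ x
  restrict-split false x = ℤP.+-identityˡ x

  sumFin-split : ∀ {n} (U : Fin n → Bool) (f : Fin n → ℤ) → sumFin f ≡ sumOver U f + sumOver (not ∘ U) f
  sumFin-split U f = trans (sumFin-cong (λ v → sym (restrict-split (U v) (f v))))
                           (sumFin-+ (λ v → if U v then f v else + 0) (λ v → if not (U v) then f v else + 0))

  restrict-nonneg : ∀ b {x : ℤ} → x ≥ + 0 → (if b then x else + 0) ≥ + 0
  restrict-nonneg true  x≥0 = x≥0
  restrict-nonneg false _   = ℤP.≤-refl

  sumOver-nonneg : ∀ {n} (U : Fin n → Bool) {f : Fin n → ℤ} → (∀ v → f v ≥ + 0) → sumOver U f ≥ + 0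
  sumOver-nonneg U f≥0 = sumFin-nonneg (λ v → restrict-nonneg (U v) (f≥0 v))

  sumOver≤sumFin : ∀ {n} (U : Fin n → Bool) {f : Fin n → ℤ} → (∀ v → f v ≥ + 0) → sumOver U f ≤ sumFin f
  sumOver≤sumFin U {f} f≥0 = subst (sumOver U f ≤_) (sym (sumFin-split U f))
    (ℤP.i≤i+j _ _ {{ℤ.nonNegative (sumOver-nonneg (not ∘ U) f≥0)}})

  sumOver-sub : ∀ {n} (U : Fin n → Bool) (f g : Fin n → ℤ) → sumOver U (λ v → f v - g v) ≡ sumOver U f - sumOver U g
  sumOver-sub U f g = trans (sumFin-cong (λ v → restrict (U v)))
                          (sumFin-sub (λ v → if U v then f v else + 0) (λ v → if U v then g v else + 0))
    where
    restrict : ∀ {v} b → (if b then f v - g v else + 0) ≡ (if b then f v else + 0) - (if b then g v else + 0)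
    restrict true  = refl
    restrict false = refl

  sumOver≤0⇒zero : ∀ {n} (U : Fin n → Bool) {f : Fin n → ℤ} → (∀ v → f v ≥ + 0) → sumOver U f ≤ + 0 →
                   ∀ v → U v ≡ true → f v ≡ + 0
  sumOver≤0⇒zero U {f} f≥0 ≤0 v v∈U = ℤP.≤-antisym (ℤP.≤-trans fv≤ ≤0) (f≥0 v)
    where
    fv≤ : f v ≤ sumOver U f
    fv≤ = subst (_≤ sumOver U f) (cong (λ b → if b then f v else + 0) v∈U)
            (term≤sumFin (λ w → restrict-nonneg (U w) (f≥0 w)) v)

  Undirected : ∀ {n} → Multigraph n → Set
  Undirected G = ∀ v w → G v w ≡ G w v

  Loopless : ∀ {n} → Multigraph n → Set
  Loopless G = ∀ v → G v v ≡ 0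

  Δ : ∀ {n} → Multigraph n → (Fin n → ℤ) → Divisor n
  Δ G f v = sumFin (λ w → + G v w * (f v - f w))

  module _ {n} (G : Multigraph n) where

    Δ-valence : ∀ f v → Δ G f v ≡ f v * valence G v - sumFin (λ w → + G v w * f w)
    Δ-valence f v = begin
      sumFin (λ w → + G v w * (f v - f w))                           ≡⟨ sumFin-cong (λ w → distrib (+ G v w) (f v) (f w)) ⟩
      sumFin (λ w → f v * + G v w - + G v w * f w)                   ≡⟨ sumFin-sub (λ w → f v * + G v w) (λ w → + G v w * f w) ⟩
      sumFin (λ w → f v * + G v w) - sumFin (λ w → + G v w * f w)    ≡⟨ cong (λ x → x - sumFin (λ w → + G v w * f w)) (sumFin-*ˡ (f v) (λ w → + G v w)) ⟩
      f v * valence G v - sumFin (λ w → + G v w * f w)               ∎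
      where
      open ≡-Reasoning
      distrib : ∀ g a b → g * (a - b) ≡ a * g - g * b
      distrib = solve 3 (λ g a b → g :* (a :- b) := a :* g :- g :* b) refl

    Δ-+ : ∀ f g v → Δ G (λ u → f u + g u) v ≡ Δ G f v + Δ G g v
    Δ-+ f g v = trans (sumFin-cong (λ w → distrib (+ G v w) (f v) (g v) (f w) (g w)))
                      (sumFin-+ (λ w → + G v w * (f v - f w)) (λ w → + G v w * (g v - g w)))
      where
      distrib : ∀ c a b x y → c * ((a + b) - (x + y)) ≡ c * (a - x) + c * (b - y)
      distrib = solve 5 (λ c a b x y → c :* ((a :+ b) :- (x :+ y)) := c :* (a :- x) :+ c :* (b :- y)) refl

    Δ-neg : ∀ f v → Δ G (λ u → - f u) v ≡ - Δ G f v
    Δ-neg f v = trans (sumFin-cong (λ w → distrib (+ G v w) (f v) (f w))) (sumFin-neg (λ w → + G v w * (f v - f w)))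
      where
      distrib : ∀ c a x → c * (- a - - x) ≡ - (c * (a - x))
      distrib = solve 3 (λ c a x → c :* (:- a :- :- x) := :- (c :* (a :- x))) refl

    Δ-const : ∀ c v → Δ G (λ _ → c) v ≡ + 0
    Δ-const c v = trans (sumFin-cong (λ w → cancel (+ G v w) c)) (sumFin-zero n)
      where
      cancel : ∀ g c → g * (c - c) ≡ + 0
      cancel = solve 2 (λ g c → g :* (c :- c) := con (+ 0)) refl

    Δ-χ : ∀ a v → Δ G (χ a) v ≡ χ a v * valence G v - + G v a
    Δ-χ a v = trans (Δ-valence (χ a) v) (cong (_-_ (χ a v * valence G v)) (sumFin-*χ (λ w → + G v w) a))

    Δ-nonneg-at-max : ∀ f v → (∀ w → f w ≤ f v) → + 0 ≤ Δ G f v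
    Δ-nonneg-at-max f v max = sumFin-nonneg (λ w →
      subst (_≤ + G v w * (f v - f w)) (ℤP.*-zeroʳ (+ G v w)) (ℤP.*-monoˡ-≤-nonNeg (+ G v w) (ℤP.i≤j⇒0≤j-i (max w))))

    fire≡-Δχ : Undirected G → Loopless G → ∀ v D w → fire G v D w ≡ D w - Δ G (χ v) w
    fire≡-Δχ undirected loopless v D w = trans (fire-explicit w) (cong (_-_ (D w)) (sym (Δ-χ v w)))
      where
      fire-explicit : ∀ w → fire G v D w ≡ D w - (χ v w * valence G w - + G w v)
      fire-explicit w with v FinP.≟ w
      ... | yes refl = cong (_-_ (D v)) (sym (begin
            + 1 * valence G v - + G v v     ≡⟨ cong₂ (λ a b → a - + b) (ℤP.*-identityˡ (valence G v)) (loopless v) ⟩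
            valence G v - + 0               ≡⟨ ℤP.+-identityʳ (valence G v) ⟩
            valence G v                     ∎))
        where open ≡-Reasoning
      ... | no _ = trans (cong (λ m → D w + + m) (undirected v w))
                         (solve 3 (λ d x val → d :+ x := d :- (con (+ 0) :* val :- x)) refl (D w) (+ G w v) (valence G w))

  χ-sym : ∀ {n} (a b : Fin n) → χ a b ≡ χ b a
  χ-sym a b with a FinP.≟ b | b FinP.≟ a
  ... | yes _   | yes _   = refl
  ... | no _    | no _    = refl
  ... | yes a≡b | no b≢a  = ⊥-elim (b≢a (sym a≡b))
  ... | no a≢b  | yes b≡a = ⊥-elim (a≢b (sym b≡a))

  Δ-expand : ∀ {n} (G : Multigraph n) f w → Δ G f w ≡ sumFin (λ v → f v * Δ G (χ v) w)
  Δ-expand {n} G f w = begin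
    Δ G f w                                                         ≡⟨ Δ-valence G f w ⟩
    f w * valence G w - sumFin (λ v → + G w v * f v)                ≡⟨ cong (λ x → x * valence G w - sumFin (λ v → + G w v * f v))
                                                                         (sym (sumFin-*χ f w)) ⟩
    sumFin (λ v → f v * χ w v) * valence G w - sumFin (λ v → + G w v * f v)
                                                                    ≡⟨ cong₂ _-_ (sym (ℤP.*-comm (valence G w) _)) refl ⟩
    valence G w * sumFin (λ v → f v * χ w v) - sumFin (λ v → + G w v * f v)
                                                                    ≡⟨ cong₂ _-_ (sym (sumFin-*ˡ (valence G w) (λ v → f v * χ w v))) refl ⟩
    sumFin (λ v → valence G w * (f v * χ w v)) - sumFin (λ v → + G w v * f v)
                                                                    ≡⟨ sym (sumFin-sub (λ v → valence G w * (f v * χ w v)) (λ v → + G w v * f v)) ⟩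
    sumFin (λ v → valence G w * (f v * χ w v) - + G w v * f v)      ≡⟨ sumFin-cong (λ v → rearrange (valence G w) (f v) (χ w v) (+ G w v) (Δ-χ′ v)) ⟩
    sumFin (λ v → f v * Δ G (χ v) w)                                ∎
    where
    open ≡-Reasoning
    Δ-χ′ : ∀ v → Δ G (χ v) w ≡ χ w v * valence G w - + G w v
    Δ-χ′ v = trans (Δ-χ G v w) (cong (λ x → x * valence G w - + G w v) (χ-sym v w))
    rearrange : ∀ val fv c g {d} → d ≡ c * val - g → val * (fv * c) - g * fv ≡ fv * d
    rearrange val fv c g refl = solve 4 (λ val fv c g → val :* (fv :* c) :- g :* fv := fv :* (c :* val :- g)) refl val fv c g

  LaplacianEquiv : ∀ {n} → Multigraph n → Divisor n → Divisor n → Set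
  LaplacianEquiv G D E = ∃ λ f → ∀ w → E w ≡ D w - Δ G f w

  LaplacianEquiv-isEquivalence : ∀ {n} (G : Multigraph n) → IsEquivalence (LaplacianEquiv G)
  LaplacianEquiv-isEquivalence G = record
    { refl  = λ {D} → (λ _ → + 0) , λ w → sym (trans (cong (_-_ (D w)) (Δ-const G (+ 0) w)) (ℤP.+-identityʳ (D w)))
    ; sym   = λ {D} {E} (f , E≡) → (λ u → - f u) , λ w → begin
                D w                       ≡⟨ solve 2 (λ d l → d := (d :- l) :- (:- l)) refl (D w) (Δ G f w) ⟩
                D w - Δ G f w - - Δ G f w ≡⟨ cong₂ _-_ (sym (E≡ w)) (sym (Δ-neg G f w)) ⟩
                E w - Δ G (λ u → - f u) w ∎
    ; trans = λ {D} {E} {F} (f , E≡) (g , F≡) → (λ u → f u + g u) , λ w → begin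
                F w                            ≡⟨ trans (F≡ w) (cong (_- Δ G g w) (E≡ w)) ⟩
                D w - Δ G f w - Δ G g w        ≡⟨ solve 3 (λ d a b → d :- a :- b := d :- (a :+ b)) refl (D w) (Δ G f w) (Δ G g w) ⟩
                D w - (Δ G f w + Δ G g w)      ≡⟨ cong (_-_ (D w)) (sym (Δ-+ G f g w)) ⟩
                D w - Δ G (λ u → f u + g u) w  ∎
    }
    where open ≡-Reasoning

  module _ {n} {G : Multigraph n} (undirected : Undirected G) (loopless : Loopless G) where

    Equiv⇒LaplacianEquiv : ∀ {D E} → Equiv G D E → LaplacianEquiv G D E
    Equiv⇒LaplacianEquiv = fold (LaplacianEquiv-isEquivalence G)
      (λ {D} (v , E≡) → χ v , λ w → trans (E≡ w) (fire≡-Δχ G undirected loopless v D w))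

    Equiv-resp-≗ : Fin n → ∀ {D E E′} → Equiv G D E → E ≗ E′ → Equiv G D E′
    Equiv-resp-≗ v {E = E} {E′} D~E E≗E′ = D~E ◅◅ fwd (v , λ _ → refl) ◅ bwd (v , fire-cong) ◅ ε
      where
      fire-cong : ∀ w → fire G v E w ≡ fire G v E′ w
      fire-cong w with v FinP.≟ w
      ... | yes _ = cong (_- valence G v) (E≗E′ w)
      ... | no _  = cong (_+ + G v w) (E≗E′ w)

    fire-ℕ : ∀ v c X → Equiv G X (λ w → X w - + c * Δ G (χ v) w)
    fire-ℕ v zero    X = Equiv-resp-≗ v ε (λ w → sym (trans (cong (_-_ (X w)) (ℤP.*-zeroˡ (Δ G (χ v) w))) (ℤP.+-identityʳ (X w))))
    fire-ℕ v (suc c) X = fwd (v , λ _ → refl) ◅ Equiv-resp-≗ v (fire-ℕ v c (fire G v X)) (λ w →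
      trans (cong (_- + c * Δ G (χ v) w) (fire≡-Δχ G undirected loopless v X w))
            (solve 3 (λ x l c → (x :- l) :- c :* l := x :- (con (+ 1) :+ c) :* l) refl (X w) (Δ G (χ v) w) (+ c)))

    fire-ℤ : ∀ v c X → Equiv G X (λ w → X w - c * Δ G (χ v) w)
    fire-ℤ v (+ c)    X = fire-ℕ v c X
    fire-ℤ v -[1+ c ] X = symmetric (FireStep G) (Equiv-resp-≗ v (fire-ℕ v (suc c) Y) (λ w →
      solve 3 (λ x l s → (x :- (:- s) :* l) :- s :* l := x) refl (X w) (Δ G (χ v) w) (+ suc c)))
      where
      Y : Divisor n
      Y w = X w - -[1+ c ] * Δ G (χ v) w

    fire-family : Fin n → ∀ {m} (ι : Fin m → Fin n) (c : Fin m → ℤ) X →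
                  Equiv G X (λ w → X w - sumFin (λ i → c i * Δ G (χ (ι i)) w))
    fire-family v₀ {zero}  ι c X = Equiv-resp-≗ v₀ ε (λ w → sym (ℤP.+-identityʳ (X w)))
    fire-family v₀ {suc m} ι c X = fire-ℤ (ι fz) (c fz) X ◅◅ Equiv-resp-≗ v₀ (fire-family v₀ (ι ∘ fs) (c ∘ fs) _) (λ w →
      solve 3 (λ x a s → (x :- a) :- s := x :- (a :+ s)) refl
        (X w) (c fz * Δ G (χ (ι fz)) w) (sumFin (λ i → c (fs i) * Δ G (χ (ι (fs i))) w)))

    -- A vertex is needed only to turn a pointwise equality of divisors into a fire–unfire round trip.
    LaplacianEquiv⇒Equiv : Fin n → ∀ {D E} → LaplacianEquiv G D E → Equiv G D E
    LaplacianEquiv⇒Equiv v₀ {D} (f , E≡) = Equiv-resp-≗ v₀ (fire-family v₀ (λ v → v) f D) (λ w →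
      trans (cong (_-_ (D w)) (sym (Δ-expand G f w))) (sym (E≡ w)))

  <⇒1≤- : ∀ {a b : ℤ} → a < b → + 1 ≤ b - a
  <⇒1≤- {a} {b} a<b = subst (+ 1 ≤_) (solve 2 (λ a b → (b :- (con (+ 1) :+ a)) :+ con (+ 1) := b :- a) refl a b)
    (ℤP.+-monoˡ-≤ (+ 1) (ℤP.i≤j⇒0≤j-i (ℤP.i<j⇒suc[i]≤j a<b)))

  cut : ∀ {n} → Multigraph n → (Fin n → Bool) → ℤ
  cut G U = sumFin (λ v → sumFin (λ w → if U v ∧ not (U w) then + G v w else + 0))

  module _ {n} {G : Multigraph n} (undirected : Undirected G) where

    private
      Δ-antisymmetric : ∀ (f : Fin n → ℤ) v w → + G w v * (f w - f v) ≡ - (+ G v w * (f v - f w))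
      Δ-antisymmetric f v w = trans (cong (λ m → + m * (f w - f v)) (undirected w v))
        (solve 3 (λ g a b → g :* (b :- a) := :- (g :* (a :- b))) refl (+ G v w) (f v) (f w))

    sumFin-Δ : ∀ (f : Fin n → ℤ) → sumFin (Δ G f) ≡ + 0
    sumFin-Δ f = sumFin-antisymmetric (λ v w → + G v w * (f v - f w)) (Δ-antisymmetric f)

    cut≤sumOver-Δ : ∀ (f : Fin n → ℤ) U → (∀ v w → U v ≡ true → U w ≡ false → f w < f v) → cut G U ≤ sumOver U (Δ G f)
    cut≤sumOver-Δ f U downward = begin
      cut G U                                       ≤⟨ sumFin-mono (λ v → sumFin-mono (crossing v)) ⟩
      ΣΣ B                                          ≡⟨ sym (ℤP.+-identityˡ (ΣΣ B)) ⟩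
      + 0 + ΣΣ B                                    ≡⟨ cong (_+ ΣΣ B) (sym (sumFin-antisymmetric A A-antisymmetric)) ⟩
      ΣΣ A + ΣΣ B                                   ≡⟨ sym (sumFin-+ (λ v → sumFin (A v)) (λ v → sumFin (B v))) ⟩
      sumFin (λ v → sumFin (A v) + sumFin (B v))    ≡⟨ sumFin-cong (λ v → sym (sumFin-+ (A v) (B v))) ⟩
      sumFin (λ v → sumFin (λ w → A v w + B v w))   ≡⟨ sumFin-cong inside-and-out ⟩
      sumOver U (Δ G f)                             ∎
      where
      open ℤP.≤-Reasoning
      term : Fin n → Fin n → ℤ
      term v w = + G v w * (f v - f w)
      A B : Fin n → Fin n → ℤ
      A v w = if U v ∧ U w then term v w else + 0
      B v w = if U v ∧ not (U w) then term v w else + 0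
      ΣΣ : (Fin n → Fin n → ℤ) → ℤ
      ΣΣ h = sumFin (λ v → sumFin (h v))
      A-antisymmetric : ∀ v w → A w v ≡ - A v w
      A-antisymmetric v w with U v | U w
      ... | true  | true  = Δ-antisymmetric f v w
      ... | true  | false = refl
      ... | false | true  = refl
      ... | false | false = refl
      crossing : ∀ v w → (if U v ∧ not (U w) then + G v w else + 0) ≤ B v w
      crossing v w with U v in v∈U | U w in w∉U
      ... | true  | true  = ℤP.≤-refl
      ... | true  | false = subst (_≤ term v w) (ℤP.*-identityʳ (+ G v w))
                              (ℤP.*-monoˡ-≤-nonNeg (+ G v w) (<⇒1≤- (downward v w v∈U w∉U)))
      ... | false | _     = ℤP.≤-refl
      inside-and-out : ∀ v → sumFin (λ w → A v w + B v w) ≡ (if U v then Δ G f v else + 0)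
      inside-and-out v with U v
      ... | true  = sumFin-cong (λ w → restrict-split (U w) (term v w))
      ... | false = sumFin-zero n

  two-terms≤sumFin : ∀ {n} {f : Fin n → ℤ} → (∀ v → f v ≥ + 0) → ∀ {a b} → a ≢ b → f a + f b ≤ sumFin f
  two-terms≤sumFin {n} {f} f≥0 {a} {b} a≢b = begin
    f a + f b                         ≡⟨ cong₂ _+_ (sym (kept a a∈U)) (sym (kept b b∈U)) ⟩
    (if U a then f a else + 0) + (if U b then f b else + 0)
                                      ≡⟨ sym (sumFin-supported₂ (λ v → if U v then f v else + 0) a b a≢b dropped) ⟩
    sumOver U f                       ≤⟨ sumOver≤sumFin U f≥0 ⟩
    sumFin f                          ∎
    where
    open ℤP.≤-Reasoning
    U : Fin n → Bool
    U v = does (v FinP.≟ a) ∨ does (v FinP.≟ b)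
    a∈U : U a ≡ true
    a∈U = cong (_∨ does (a FinP.≟ b)) (dec-true (a FinP.≟ a) refl)
    b∈U : U b ≡ true
    b∈U = trans (cong (does (b FinP.≟ a) ∨_) (dec-true (b FinP.≟ b) refl)) (BoolP.∨-zeroʳ (does (b FinP.≟ a)))
    kept : ∀ v → U v ≡ true → (if U v then f v else + 0) ≡ f v
    kept v v∈U = cong (λ x → if x then f v else + 0) v∈U
    dropped : ∀ v → v ≢ a → v ≢ b → (if U v then f v else + 0) ≡ + 0
    dropped v v≢a v≢b = cong (λ x → if x then f v else + 0)
      (cong₂ _∨_ (dec-false (v FinP.≟ a) v≢a) (dec-false (v FinP.≟ b) v≢b))

module GonalityFromCuts where

  open import Defs
  open Laplacian
  open import Data.Nat as ℕ using (ℕ; zero; suc)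
  open import Data.Fin as Fin using (Fin) renaming (zero to fz; suc to fs)
  import Data.Fin.Properties as FinP
  open import Data.Integer as ℤ using (ℤ; +_; _+_; _-_; -_; _*_; _≤_; _<_; +≤+)
  import Data.Integer.Properties as ℤP
  open import Data.Integer.Solver using (module +-*-Solver)
  open +-*-Solver
  open import Data.Bool using (Bool; true; false; not; if_then_else_)
  open import Data.Product using (∃; ∃₂; _×_; _,_; proj₁; proj₂)
  open import Data.Sum using (_⊎_; inj₁; inj₂)
  open import Data.Empty using (⊥-elim)
  open import Function using (_∘_)
  open import Relation.Nullary using (yes; no; ¬_; does; Dec)
  open import Relation.Nullary.Decidable using (dec-true; dec-false)
  open import Relation.Binary.PropositionalEquality
  open import Relation.Binary.Structures using (IsEquivalence)

  Proper : ∀ {n} → (Fin n → Bool) → Set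
  Proper U = (∃ λ v → U v ≡ true) × (∃ λ w → U w ≡ false)

  AlmostConstant : ∀ {n} → (Fin n → Bool) → Set
  AlmostConstant U = ∃₂ λ z b → ∀ v → v ≢ z → U v ≡ b

  record PositiveRankRep {n} (G : Multigraph n) (d : ℤ) : Set where
    field
      D₀           : Divisor n
      D₀-effective : Effective D₀
      deg-D₀       : deg D₀ ≡ d
      reach        : ∀ q → ∃ λ E → Effective E × + 1 ≤ E q × LaplacianEquiv G D₀ E

  deg-LaplacianEquiv : ∀ {n} {G : Multigraph n} → Undirected G → ∀ {D E} → LaplacianEquiv G D E → deg E ≡ deg D
  deg-LaplacianEquiv {G = G} undirected {D} {E} (f , E≡) = begin
    deg E                         ≡⟨ sumFin-cong E≡ ⟩
    sumFin (λ w → D w - Δ G f w)  ≡⟨ sumFin-sub D (Δ G f) ⟩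
    deg D - sumFin (Δ G f)        ≡⟨ cong (_-_ (deg D)) (sumFin-Δ undirected f) ⟩
    deg D - + 0                   ≡⟨ ℤP.+-identityʳ (deg D) ⟩
    deg D                         ∎
    where open ≡-Reasoning

  minusPt≡-χ : ∀ {n} (D : Divisor n) q w → minusPt D q w ≡ D w - χ q w
  minusPt≡-χ D q w with q FinP.≟ w
  ... | yes _ = refl
  ... | no _  = sym (ℤP.+-identityʳ (D w))

  module _ {n} {G : Multigraph n} (undirected : Undirected G) (loopless : Loopless G) where

    private
      open IsEquivalence (LaplacianEquiv-isEquivalence G) using () renaming (sym to ~-sym; trans to ~-trans)

      add-point : ∀ {D q E} → LaplacianEquiv G (minusPt D q) E → LaplacianEquiv G D (λ w → E w + χ q w)
      add-point {D} {q} {E} (f , E≡) = f , λ w → begin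
        E w + χ q w                       ≡⟨ cong (_+ χ q w) (trans (E≡ w) (cong (_- Δ G f w) (minusPt≡-χ D q w))) ⟩
        D w - χ q w - Δ G f w + χ q w     ≡⟨ solve 3 (λ d x l → d :- x :- l :+ x := d :- l) refl (D w) (χ q w) (Δ G f w) ⟩
        D w - Δ G f w                     ∎
        where open ≡-Reasoning

    positiveRank⇒rep : Fin n → ∀ {D} → PositiveRank G D → PositiveRankRep G (deg D)
    positiveRank⇒rep q₀ {D} rank = record
      { D₀           = raised q₀
      ; D₀-effective = raised-effective q₀
      ; deg-D₀       = deg-LaplacianEquiv undirected (lift q₀)
      ; reach        = λ q → raised q , raised-effective q , raised≥1 q ,
                             ~-trans {raised q₀} {D} (~-sym {D} {raised q₀} (lift q₀)) (lift q)
      }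
      where
      raised : Fin n → Divisor n
      raised q w = proj₁ (rank q) w + χ q w
      raised-effective : ∀ q → Effective (raised q)
      raised-effective q w = ℤP.+-mono-≤ (proj₁ (proj₂ (rank q)) w) (χ-nonneg q w)
      raised≥1 : ∀ q → + 1 ≤ raised q q
      raised≥1 q = subst (λ x → + 1 ≤ proj₁ (rank q) q + x) (sym (χ-same q))
                     (ℤP.+-monoˡ-≤ (+ 1) {+ 0} {proj₁ (rank q) q} (proj₁ (proj₂ (rank q)) q))
      lift : ∀ q → LaplacianEquiv G D (raised q)
      lift q = add-point {D} {q} (Equiv⇒LaplacianEquiv undirected loopless (proj₂ (proj₂ (rank q))))

    dominating-script⇒witness : Fin n → ∀ D q (f : Fin n → ℤ) → (∀ w → χ q w ≤ D w - Δ G f w) →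
                                ∃ λ E → Effective E × Equiv G (minusPt D q) E
    dominating-script⇒witness v₀ D q f dominated =
        (λ w → minusPt D q w - Δ G f w)
      , (λ w → subst (+ 0 ≤_) (sym (rearranged w)) (ℤP.i≤j⇒0≤j-i (dominated w)))
      , LaplacianEquiv⇒Equiv undirected loopless v₀ (f , λ w → refl)
      where
      rearranged : ∀ w → minusPt D q w - Δ G f w ≡ D w - Δ G f w - χ q w
      rearranged w = trans (cong (_- Δ G f w) (minusPt≡-χ D q w))
                           (solve 3 (λ d x l → d :- x :- l := d :- l :- x) refl (D w) (χ q w) (Δ G f w))

  1≰0 : ¬ (+ 1 ≤ + 0)
  1≰0 (+≤+ ())

  nonzero⇒≥1 : ∀ {a : ℤ} → + 0 ≤ a → a ≢ + 0 → + 1 ≤ a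
  nonzero⇒≥1 {+ zero}  _ a≢0 = ⊥-elim (a≢0 refl)
  nonzero⇒≥1 {+ suc a} _ _   = +≤+ (ℕ.s≤s ℕ.z≤n)

  argmax : ∀ {n} → Fin n → (g : Fin n → ℤ) → ∃ λ v → ∀ w → g w ≤ g v
  argmax {suc zero}    _ g = fz , λ { fz → ℤP.≤-refl }
  argmax {suc (suc n)} _ g with argmax fz (g ∘ fs) | g fz ℤ.≤? g (fs (proj₁ (argmax fz (g ∘ fs))))
  ... | v , max | yes g0≤ = fs v , λ { fz → g0≤ ; (fs w) → max w }
  ... | v , max | no g0≰  = fz , λ { fz → ℤP.≤-refl ; (fs w) → ℤP.≤-trans (max w) (ℤP.<⇒≤ (ℤP.≰⇒> g0≰)) }

  above : ∀ {n} → (Fin n → ℤ) → ℤ → Fin n → Bool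
  above g t v = does (t ℤ.≤? g v)

  module _ {n} (g : Fin n → ℤ) (t : ℤ) where

    above-true : ∀ {v} → t ≤ g v → above g t v ≡ true
    above-true {v} = dec-true (t ℤ.≤? g v)

    above-false : ∀ {v} → g v < t → above g t v ≡ false
    above-false {v} gv<t = dec-false (t ℤ.≤? g v) (ℤP.<⇒≱ gv<t)

    above-true⁻¹ : ∀ v → above g t v ≡ true → t ≤ g v
    above-true⁻¹ v _ with t ℤ.≤? g v
    above-true⁻¹ v _  | yes t≤gv = t≤gv
    above-true⁻¹ v () | no _

    above-false⁻¹ : ∀ v → above g t v ≡ false → g v < t
    above-false⁻¹ v _ with t ℤ.≤? g v
    above-false⁻¹ v () | yes _
    above-false⁻¹ v _  | no t≰gv = ℤP.≰⇒> t≰gv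

    above-proper : ∀ {v w} → t ≤ g v → g w < t → Proper (above g t)
    above-proper t≤gv gw<t = (_ , above-true t≤gv) , (_ , above-false gw<t)

  module LevelSets {n} {G : Multigraph n} (undirected : Undirected G)
    {D₁ D₂ : Divisor n} {g : Fin n → ℤ} (D₁-effective : Effective D₁) (D₂-effective : Effective D₂)
    (D₂≡ : ∀ w → D₂ w ≡ D₁ w - Δ G g w) where

    private
      inside outside : ℤ → Divisor n → ℤ
      inside  t D = sumOver (above g t) D
      outside t D = sumOver (not ∘ above g t) D

    cut-above≤ : ∀ t → cut G (above g t) ≤ inside t D₁ - inside t D₂
    cut-above≤ t = begin
      cut G (above g t)                           ≤⟨ cut≤sumOver-Δ undirected g (above g t) (λ v w v∈ w∉ →
                                                       ℤP.<-≤-trans (above-false⁻¹ g t w w∉) (above-true⁻¹ g t v v∈)) ⟩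
      sumOver (above g t) (Δ G g)                 ≡⟨ sumFin-cong (λ v → cong (λ x → if above g t v then x else + 0) (Δ≡ v)) ⟩
      sumOver (above g t) (λ v → D₁ v - D₂ v)     ≡⟨ sumOver-sub (above g t) D₁ D₂ ⟩
      inside t D₁ - inside t D₂                   ∎
      where
      open ℤP.≤-Reasoning
      Δ≡ : ∀ v → Δ G g v ≡ D₁ v - D₂ v
      Δ≡ v = trans (solve 2 (λ d l → l := d :- (d :- l)) refl (D₁ v) (Δ G g v)) (cong (_-_ (D₁ v)) (sym (D₂≡ v)))

    cut-above≤deg : ∀ t → cut G (above g t) ≤ deg D₁
    cut-above≤deg t = ℤP.≤-trans (cut-above≤ t)
      (ℤP.≤-trans (ℤP.i-j≤i _ _ {{ℤ.nonNegative (sumOver-nonneg (above g t) D₂-effective)}})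
                  (sumOver≤sumFin (above g t) D₁-effective))

    tight : ∀ t → deg D₁ ≤ cut G (above g t) →
            (∀ v → g v < t → D₁ v ≡ + 0) × (∀ v → t ≤ g v → D₂ v ≡ + 0)
    tight t deg≤cut =
        (λ v gv<t → sumOver≤0⇒zero (not ∘ above g t) D₁-effective outside≤0 v (cong not (above-false g t gv<t)))
      , (λ v t≤gv → sumOver≤0⇒zero (above g t) D₂-effective inside≤0 v (above-true g t t≤gv))
      where
      a = inside t D₁
      b = inside t D₂
      c = outside t D₁
      sum≤0 : c + b ≤ + 0
      sum≤0 = subst₂ _≤_ (solve 3 (λ a b c → (a :+ c) :+ (b :- a) := c :+ b) refl a b c)
                         (solve 2 (λ a b → (a :- b) :+ (b :- a) := con (+ 0)) refl a b)
                         (ℤP.+-monoˡ-≤ (b - a) (ℤP.≤-trans (ℤP.≤-reflexive (sym (sumFin-split (above g t) D₁)))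
                                                           (ℤP.≤-trans deg≤cut (cut-above≤ t))))
      outside≤0 : c ≤ + 0
      outside≤0 = ℤP.≤-trans (ℤP.i≤i+j c b {{ℤ.nonNegative (sumOver-nonneg (above g t) D₂-effective)}}) sum≤0
      inside≤0 : b ≤ + 0
      inside≤0 = ℤP.≤-trans (ℤP.i≤j+i b c {{ℤ.nonNegative (sumOver-nonneg (not ∘ above g t) D₁-effective)}}) sum≤0

    exceeded-somewhere : ∀ q → D₁ q ≡ + 0 → + 1 ≤ D₂ q → ∃ λ v → g q < g v
    exceeded-somewhere q D₁q≡0 1≤D₂q with argmax q g
    ... | v , max with g q ℤ.<? g v
    ...   | yes gq<gv = v , gq<gv
    ...   | no gq≮gv  = ⊥-elim (1≰0 (ℤP.≤-trans 1≤D₂q D₂q≤0))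
      where
      D₂q≤0 : D₂ q ≤ + 0
      D₂q≤0 = begin
        D₂ q                ≡⟨ trans (D₂≡ q) (cong (_- Δ G g q) D₁q≡0) ⟩
        + 0 - Δ G g q       ≡⟨ ℤP.+-identityˡ (- Δ G g q) ⟩
        - Δ G g q           ≤⟨ ℤP.neg-mono-≤ (Δ-nonneg-at-max G g q (λ w → ℤP.≤-trans (max w) (ℤP.≮⇒≥ gq≮gv))) ⟩
        + 0                 ∎
        where open ℤP.≤-Reasoning

  module _ {n} {G : Multigraph n} (undirected : Undirected G) (c : ℕ) (c≤n : c ℕ.≤ n)
           (cut≥c : ∀ U → Proper U → + c ≤ cut G U) where

    rep-deg≥ : ∀ {d} → PositiveRankRep G d → + c ≤ d
    rep-deg≥ rep = subst (+ c ≤_) deg-D₀ (by-cases (FinP.any? (λ q → D₀ q ℤ.≟ + 0)))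
      where
      open PositiveRankRep rep
      from-reach : ∀ q → D₀ q ≡ + 0 → (∃ λ E → Effective E × + 1 ≤ E q × LaplacianEquiv G D₀ E) → + c ≤ deg D₀
      from-reach q D₀q≡0 (E , E-effective , 1≤Eq , g , E≡) =
        let (v , gq<gv) = exceeded-somewhere q D₀q≡0 1≤Eq in
        ℤP.≤-trans (cut≥c _ (above-proper g (g v) ℤP.≤-refl gq<gv)) (cut-above≤deg (g v))
        where open LevelSets undirected {g = g} D₀-effective E-effective E≡
      by-cases : Dec (∃ λ q → D₀ q ≡ + 0) → + c ≤ deg D₀
      by-cases (yes (q , D₀q≡0)) = from-reach q D₀q≡0 (reach q)
      by-cases (no no-zero)      = ℤP.≤-trans (ℤ.+≤+ c≤n)
                                     (n≤sumFin (λ v → nonzero⇒≥1 (D₀-effective v) (λ D₀v≡0 → no-zero (v , D₀v≡0))))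

  +1≤* : ∀ {a : ℕ} {b : ℤ} → 1 ℕ.≤ a → + 1 ≤ b → + 1 ≤ + a * b
  +1≤* {a} {b} 1≤a 1≤b = ℤP.≤-trans (ℤ.+≤+ 1≤a)
    (subst (_≤ + a * b) (ℤP.*-identityʳ (+ a)) (ℤP.*-monoˡ-≤-nonNeg (+ a) 1≤b))

  data Shape {n} (G : Multigraph n) (c : ℕ) (D : Divisor n) (q : Fin n) : Set where
    concentrated : ∀ x → + c ≤ D x → (∀ v → v ≢ x → D v ≡ + 0) →
                   1 ℕ.≤ G q x ⊎ (∀ u → u ≢ x → u ≢ q → 1 ℕ.≤ G u x → 1 ℕ.≤ G u q) → Shape G c D q
    spread : ∀ m → + 1 ≤ m → (∀ u → u ≢ q → D u ≡ m * + G u q) → Shape G c D q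

  module ShapeLemma {n} {G : Multigraph n} (undirected : Undirected G) (c : ℕ)
    (cut≥c : ∀ U → Proper U → + c ≤ cut G U)
    (cut≤c⇒almostConstant : ∀ U → Proper U → cut G U ≤ + c → AlmostConstant U)
    {D₁ D₂ : Divisor n} (g : Fin n → ℤ) (D₁-effective : Effective D₁) (D₂-effective : Effective D₂)
    (D₂≡ : ∀ w → D₂ w ≡ D₁ w - Δ G g w) (deg≤c : deg D₁ ≤ + c)
    (q : Fin n) (D₁q≡0 : D₁ q ≡ + 0) (1≤D₂q : + 1 ≤ D₂ q) where

    open LevelSets undirected {g = g} D₁-effective D₂-effective D₂≡

    private
      cut≤c : ∀ t → cut G (above g t) ≤ + c
      cut≤c t = ℤP.≤-trans (cut-above≤deg t) deg≤c

    tight-at : ∀ t {x y} → t ≤ g x → g y < t → (∀ v → g v < t → D₁ v ≡ + 0) × (∀ v → t ≤ g v → D₂ v ≡ + 0)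
    tight-at t t≤gx gy<t = tight t (ℤP.≤-trans deg≤c (cut≥c _ (above-proper g t t≤gx gy<t)))

    split-at : ∀ t {x y} → t ≤ g x → g y < t → (∀ v → v ≢ x → g v < t) ⊎ (∀ v → v ≢ y → t ≤ g v)
    split-at t {x} {y} t≤gx gy<t = from (cut≤c⇒almostConstant _ (above-proper g t t≤gx gy<t) (cut≤c t))
      where
      from : AlmostConstant (above g t) → (∀ v → v ≢ x → g v < t) ⊎ (∀ v → v ≢ y → t ≤ g v)
      from (z , false , const) = inj₁ λ v v≢x → above-false⁻¹ g t v (const v (λ v≡z → v≢x (trans v≡z (sym x≡z))))
        where
        x≡z : x ≡ z
        x≡z with x FinP.≟ z
        ... | yes x≡z = x≡z
        ... | no x≢z  = ⊥-elim (true≢false (trans (sym (above-true g t t≤gx)) (const x x≢z)))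
          where true≢false : true ≢ false
                true≢false ()
      from (z , true , const) = inj₂ λ v v≢y → above-true⁻¹ g t v (const v (λ v≡z → v≢y (trans v≡z (sym y≡z))))
        where
        y≡z : y ≡ z
        y≡z with y FinP.≟ z
        ... | yes y≡z = y≡z
        ... | no y≢z  = ⊥-elim (false≢true (trans (sym (above-false g t gy<t)) (const y y≢z)))
          where false≢true : false ≢ true
                false≢true ()

    q-min : ∀ w → g q ≤ g w
    q-min w with g w ℤ.<? g q
    ... | no gw≮gq = ℤP.≮⇒≥ gw≮gq
    ... | yes gw<gq = ⊥-elim (1≰0 (ℤP.≤-trans 1≤D₂q (ℤP.≤-reflexive (proj₂ (tight-at (g q) ℤP.≤-refl gw<gq) q ℤP.≤-refl))))

    private
      Δ≡D₁ : ∀ u → D₂ u ≡ + 0 → Δ G g u ≡ D₁ u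
      Δ≡D₁ u D₂u≡0 = trans (solve 2 (λ d l → l := d :- (d :- l)) refl (D₁ u) (Δ G g u))
                           (trans (cong (_-_ (D₁ u)) (sym (D₂≡ u))) (trans (cong (_-_ (D₁ u)) D₂u≡0) (ℤP.+-identityʳ (D₁ u))))

      term-vanishes : ∀ u w → g u ≡ g w → + G u w * (g u - g w) ≡ + 0
      term-vanishes u w gu≡gw = trans (cong (λ x → + G u w * (x - g w)) gu≡gw)
                                      (trans (cong (+ G u w *_) (ℤP.+-inverseʳ (g w))) (ℤP.*-zeroʳ (+ G u w)))

    module _ (vM : Fin n) (max : ∀ w → g w ≤ g vM) (gq<M : g q < g vM) where

      private
        M = g vM
        t = + 1 + g q
        t≤M : t ≤ M
        t≤M = ℤP.i<j⇒suc[i]≤j gq<M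
        gq<t : g q < t
        gq<t = ℤP.suc[i]≤j⇒i<j ℤP.≤-refl

      spread-shape : (∀ v → v ≢ q → M ≤ g v) → Shape G c D₁ q
      spread-shape high = spread (M - g q) (<⇒1≤- gq<M) λ u u≢q → begin
        D₁ u                               ≡⟨ sym (Δ≡D₁ u (proj₂ (tight-at M ℤP.≤-refl gq<M) u (high u u≢q))) ⟩
        Δ G g u                            ≡⟨ sumFin-supported₁ _ q (λ w w≢q → term-vanishes u w (trans (at-M u u≢q) (sym (at-M w w≢q)))) ⟩
        + G u q * (g u - g q)              ≡⟨ trans (cong (λ x → + G u q * (x - g q)) (at-M u u≢q)) (ℤP.*-comm (+ G u q) _) ⟩
        (M - g q) * + G u q                ∎
        where
        open ≡-Reasoning
        at-M : ∀ v → v ≢ q → g v ≡ M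
        at-M v v≢q = ℤP.≤-antisym (max v) (high v v≢q)

      module _ (low : ∀ v → v ≢ vM → g v < M) where

        private
          D₁-off : ∀ v → v ≢ vM → D₁ v ≡ + 0
          D₁-off v v≢vM = proj₁ (tight-at M ℤP.≤-refl gq<M) v (low v v≢vM)

          c≤D₁vM : + c ≤ D₁ vM
          c≤D₁vM = ℤP.≤-trans (cut≥c _ (above-proper g M ℤP.≤-refl gq<M))
                     (ℤP.≤-trans (cut-above≤deg M) (ℤP.≤-reflexive (sumFin-supported₁ D₁ vM D₁-off)))

          concentrated-at : 1 ℕ.≤ G q vM ⊎ (∀ u → u ≢ vM → u ≢ q → 1 ℕ.≤ G u vM → 1 ℕ.≤ G u q) → Shape G c D₁ q
          concentrated-at = concentrated vM c≤D₁vM D₁-off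

        neighbour-shape : (∀ v → v ≢ vM → g v < t) → Shape G c D₁ q
        neighbour-shape near-q = concentrated-at (inj₁ (G-pos (G q vM) refl))
          where
          flat : ∀ v → v ≢ vM → g q ≡ g v
          flat v v≢vM = ℤP.≤-antisym (q-min v)
                          (subst (g v ≤_) (ℤP.pred-suc (g q)) (ℤP.i<j⇒i≤pred[j] (near-q v v≢vM)))
          D₂q≡ : D₂ q ≡ + G q vM * (M - g q)
          D₂q≡ = begin
            D₂ q                           ≡⟨ trans (D₂≡ q) (cong (_- Δ G g q) D₁q≡0) ⟩
            + 0 - Δ G g q                  ≡⟨ cong (_-_ (+ 0)) (sumFin-supported₁ _ vM (λ w w≢vM → term-vanishes q w (flat w w≢vM))) ⟩
            + 0 - + G q vM * (g q - M)     ≡⟨ solve 3 (λ a x y → con (+ 0) :- a :* (x :- y) := a :* (y :- x)) refl (+ G q vM) (g q) M ⟩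
            + G q vM * (M - g q)           ∎
            where open ≡-Reasoning
          G-pos : ∀ m → G q vM ≡ m → 1 ℕ.≤ m
          G-pos zero    G≡0 = ⊥-elim (1≰0 (ℤP.≤-trans 1≤D₂q (ℤP.≤-reflexive
                                (trans D₂q≡ (trans (cong (λ m → + m * (M - g q)) G≡0) refl)))))
          G-pos (suc m) _   = ℕ.s≤s ℕ.z≤n

        bridge-shape : (∀ v → v ≢ q → t ≤ g v) → Shape G c D₁ q
        bridge-shape far-q = concentrated-at (inj₂ bridged)
          where
          D₂-off : ∀ v → v ≢ q → D₂ v ≡ + 0
          D₂-off v v≢q = proj₂ (tight-at t t≤M gq<t) v (far-q v v≢q)
          gq<g : ∀ v → v ≢ q → g q < g v
          gq<g v v≢q = ℤP.<-≤-trans gq<t (far-q v v≢q)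
          middle≤ : ∀ u w → u ≢ vM → u ≢ q → w ≢ q → g u ≤ g w
          middle≤ u w u≢vM u≢q w≢q with split-at (g u) {u} {q} ℤP.≤-refl (gq<g u u≢q)
          ... | inj₁ below-u = ⊥-elim (ℤP.<-irrefl refl (ℤP.<-≤-trans (below-u vM (u≢vM ∘ sym)) (max u)))
          ... | inj₂ above-u = above-u w w≢q
          bridged : ∀ u → u ≢ vM → u ≢ q → 1 ℕ.≤ G u vM → 1 ℕ.≤ G u q
          bridged u u≢vM u≢q 1≤Guv = G-pos (G u q) refl
            where
            balance : + G u vM * (M - g u) ≡ + G u q * (g u - g q)
            balance = begin
              + G u vM * (M - g u)                                  ≡⟨ solve 5 (λ a b m x y → a :* (m :- x) := b :* (x :- y) :- (a :* (x :- m) :+ b :* (x :- y))) refl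
                                                                         (+ G u vM) (+ G u q) M (g u) (g q) ⟩
              + G u q * (g u - g q) - (+ G u vM * (g u - M) + + G u q * (g u - g q))
                                                                    ≡⟨ cong (_-_ (+ G u q * (g u - g q))) (sym Δu≡) ⟩
              + G u q * (g u - g q) - Δ G g u                       ≡⟨ cong (_-_ (+ G u q * (g u - g q))) (trans (Δ≡D₁ u (D₂-off u u≢q)) (D₁-off u u≢vM)) ⟩
              + G u q * (g u - g q) - + 0                           ≡⟨ ℤP.+-identityʳ _ ⟩
              + G u q * (g u - g q)                                 ∎
              where
              open ≡-Reasoning
              Δu≡ : Δ G g u ≡ + G u vM * (g u - M) + + G u q * (g u - g q)
              Δu≡ = sumFin-supported₂ _ vM q (λ vM≡q → ℤP.<-irrefl (cong g (sym vM≡q)) gq<M) (λ w w≢vM w≢q →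
                      term-vanishes u w (ℤP.≤-antisym (middle≤ u w u≢vM u≢q w≢q) (middle≤ w u w≢vM w≢q u≢q)))
            G-pos : ∀ m → G u q ≡ m → 1 ℕ.≤ m
            G-pos zero    G≡0 = ⊥-elim (1≰0 (ℤP.≤-trans (+1≤* 1≤Guv (<⇒1≤- (low u u≢vM)))
                                  (ℤP.≤-reflexive (trans balance (trans (cong (λ m → + m * (g u - g q)) G≡0) refl)))))
            G-pos (suc m) _   = ℕ.s≤s ℕ.z≤n

      shape-from-max : Shape G c D₁ q
      shape-from-max with split-at M {vM} {q} ℤP.≤-refl gq<M
      ... | inj₂ high = spread-shape high
      ... | inj₁ low with split-at t {vM} {q} t≤M gq<t
      ...   | inj₁ near-q = neighbour-shape low near-q
      ...   | inj₂ far-q  = bridge-shape low far-q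

    shape : Shape G c D₁ q
    shape with argmax q g | exceeded-somewhere q D₁q≡0 1≤D₂q
    ... | vM , max | v , gq<gv = shape-from-max vM max (ℤP.<-≤-trans gq<gv (max v))

  rep-shape : ∀ {n} {G : Multigraph n} → Undirected G → ∀ c →
              (∀ U → Proper U → + c ≤ cut G U) → (∀ U → Proper U → cut G U ≤ + c → AlmostConstant U) →
              ∀ {d} (rep : PositiveRankRep G d) → d ≤ + c →
              ∀ q → PositiveRankRep.D₀ rep q ≡ + 0 → Shape G c (PositiveRankRep.D₀ rep) q
  rep-shape {G = G} undirected c cut≥c cut≤c⇒almostConstant rep d≤c q D₀q≡0 = from-reach (reach q)
    where
    open PositiveRankRep rep
    from-reach : (∃ λ E → Effective E × + 1 ≤ E q × LaplacianEquiv G D₀ E) → Shape G c D₀ q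
    from-reach (E , E-effective , 1≤Eq , g , E≡) =
      ShapeLemma.shape undirected c cut≥c cut≤c⇒almostConstant g D₀-effective E-effective E≡
        (subst (_≤ + c) (sym deg-D₀) d≤c) q D₀q≡0 1≤Eq

module HararyIndices where

  open import Data.Nat as ℕ using (ℕ; zero; suc; _+_; _≤_; _<_; z≤n; s≤s; _∸_; ∣_-_∣; ⌊_/2⌋)
  import Data.Nat.Properties as ℕP
  open import Data.Product using (_×_; _,_)
  open import Data.Sum using (_⊎_; inj₁; inj₂)
  open import Data.Empty using (⊥-elim)
  open import Relation.Nullary using (yes; no; ¬_; Dec)
  open import Relation.Binary.PropositionalEquality

  x+p<sp⇒x≡0 : ∀ {x p} → x + p < suc p → x ≡ 0
  x+p<sp⇒x≡0 {zero}      _ = refl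
  x+p<sp⇒x≡0 {suc x} {p} h = ⊥-elim (ℕP.m+n≮n x p (ℕP.≤-pred h))

  suc≡+1 : ∀ a → a + 1 ≡ suc a
  suc≡+1 a = ℕP.+-comm a 1

  ∣m+n-m∣≡n : ∀ m n → ∣ m + n - m ∣ ≡ n
  ∣m+n-m∣≡n m n = trans (ℕP.∣-∣-comm (m + n) m) (ℕP.∣m-m+n∣≡n m n)

  module HararyIndex (k₁ : ℕ) (1≤k₁ : 1 ≤ k₁) where

    k : ℕ
    k = suc k₁

    n : ℕ
    n = k + k

    n₁ : ℕ
    n₁ = k₁ + suc k₁

    ⌊n/2⌋≡k : ⌊ n /2⌋ ≡ k
    ⌊n/2⌋≡k = sym (ℕP.n≡⌊n+n/2⌋ k)

    Adj : ℕ → ℕ → Set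
    Adj a b = ∣ a - b ∣ ≡ 1 ⊎ ∣ a - b ∣ ≡ n ∸ 1 ⊎ ∣ a - b ∣ ≡ ⌊ n /2⌋

    Adj-sym : ∀ {a b} → Adj a b → Adj b a
    Adj-sym {a} {b} (inj₁ e) = inj₁ (trans (ℕP.∣-∣-comm b a) e)
    Adj-sym {a} {b} (inj₂ (inj₁ e)) = inj₂ (inj₁ (trans (ℕP.∣-∣-comm b a) e))
    Adj-sym {a} {b} (inj₂ (inj₂ e)) = inj₂ (inj₂ (trans (ℕP.∣-∣-comm b a) e))

    Adj-irrefl : ∀ a → ¬ Adj a a
    Adj-irrefl a (inj₁ e) = 0≢ (trans (sym (ℕP.∣n-n∣≡0 a)) e)
      where
      0≢ : ¬ 0 ≡ 1
      0≢ ()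
    Adj-irrefl a (inj₂ (inj₁ e)) = 0≢ (trans (sym (ℕP.∣n-n∣≡0 a)) e)
      where
      0≢ : ¬ 0 ≡ n₁
      0≢ e with trans e (ℕP.+-suc k₁ k₁)
      ... | ()
    Adj-irrefl a (inj₂ (inj₂ e)) = 0≢ (trans (trans (sym (ℕP.∣n-n∣≡0 a)) e) ⌊n/2⌋≡k)
      where
      0≢ : ¬ 0 ≡ k
      0≢ ()

    k<n : k < n
    k<n = ℕP.m<m+n k (s≤s z≤n)

    nextᵢ : ℕ → ℕ
    nextᵢ a with suc a ℕ.<? n
    ... | yes _ = suc a
    ... | no _ = 0

    prevᵢ : ℕ → ℕ
    prevᵢ zero = n₁
    prevᵢ (suc a) = a

    oppᵢ : ℕ → ℕ
    oppᵢ a with a ℕ.<? k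
    ... | yes _ = a + k
    ... | no _ = a ∸ k

    n₁<n : n₁ < n
    n₁<n = ℕP.≤-refl

    nextᵢ<n : ∀ a → nextᵢ a < n
    nextᵢ<n a with suc a ℕ.<? n
    ... | yes p = p
    ... | no _ = s≤s z≤n

    prevᵢ<n : ∀ a → a < n → prevᵢ a < n
    prevᵢ<n zero _ = n₁<n
    prevᵢ<n (suc a) lt = ℕP.<-trans (ℕP.n<1+n a) lt

    oppᵢ<n : ∀ a → a < n → oppᵢ a < n
    oppᵢ<n a lt with a ℕ.<? k
    ... | yes p = ℕP.+-monoˡ-< k p
    ... | no _ = ℕP.≤-<-trans (ℕP.m∸n≤m a k) lt

    last≡n₁ : ∀ a → a < n → ¬ suc a < n → a ≡ n₁
    last≡n₁ a lt nl = ℕP.≤-antisym (ℕP.≤-pred lt) (ℕP.≤-pred (ℕP.≮⇒≥ nl))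

    Adj-next : ∀ a → a < n → Adj a (nextᵢ a)
    Adj-next a lt with suc a ℕ.<? n
    ... | yes p = inj₁ (trans (cong (λ z → ∣ a - z ∣) (sym (suc≡+1 a))) (ℕP.∣m-m+n∣≡n a 1))
    ... | no np = inj₂ (inj₁ (trans (ℕP.∣-∣-identityʳ a) (last≡n₁ a lt np)))

    Adj-prev : ∀ a → Adj a (prevᵢ a)
    Adj-prev zero = inj₂ (inj₁ refl)
    Adj-prev (suc a) = inj₁ (trans (cong (λ z → ∣ z - a ∣) (sym (suc≡+1 a))) (∣m+n-m∣≡n a 1))

    Adj-opp : ∀ a → a < n → Adj a (oppᵢ a)
    Adj-opp a lt with a ℕ.<? k
    ... | yes p = inj₂ (inj₂ (trans (ℕP.∣m-m+n∣≡n a k) (sym ⌊n/2⌋≡k)))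
    ... | no np = inj₂ (inj₂
        (trans (cong (λ z → ∣ z - (a ∸ k) ∣) (sym (ℕP.m+[n∸m]≡n (ℕP.≮⇒≥ np))))
        (trans (cong (λ z → ∣ z - (a ∸ k) ∣) (ℕP.+-comm k (a ∸ k))) (trans (∣m+n-m∣≡n (a ∸ k) k) (sym ⌊n/2⌋≡k)))))

    2≤k : 2 ≤ k
    2≤k = s≤s 1≤k₁

    4≤n : 4 ≤ n
    4≤n = ℕP.+-mono-≤ 2≤k 2≤k

    k≢1 : ¬ k ≡ 1
    k≢1 e = ℕP.<-irrefl (sym e) 2≤k

    n₁∸k≡k₁ : n₁ ∸ k ≡ k₁
    n₁∸k≡k₁ = ℕP.m+n∸n≡m k₁ (suc k₁)

    k₁≢0 : ¬ k₁ ≡ 0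
    k₁≢0 e = ℕP.<-irrefl (sym e) 1≤k₁

    nextᵢ≢prevᵢ : ∀ a → a < n → ¬ nextᵢ a ≡ prevᵢ a
    nextᵢ≢prevᵢ zero lt e with 1 ℕ.<? n
    ... | yes _ = k₁≢0 (ℕP.m+n≡0⇒m≡0 k₁ (ℕP.suc-injective (trans (sym (ℕP.+-suc k₁ k₁)) (sym e))))
    ... | no np = np (ℕP.≤-trans (s≤s (s≤s z≤n)) 4≤n)
    nextᵢ≢prevᵢ (suc a) lt e with suc (suc a) ℕ.<? n
    ... | yes _ = ℕP.<-irrefl (sym e) (ℕP.≤-trans (ℕP.n≤1+n (suc a)) ℕP.≤-refl)
    ... | no np = np (subst (λ z → suc (suc z) < n) e (ℕP.≤-trans (s≤s (s≤s (s≤s z≤n))) 4≤n))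

    nextᵢ≢oppᵢ : ∀ a → a < n → ¬ nextᵢ a ≡ oppᵢ a
    nextᵢ≢oppᵢ a lt e with suc a ℕ.<? n | a ℕ.<? k
    ... | yes _ | yes _ = k≢1 (ℕP.+-cancelˡ-≡ a k 1 (sym (trans (suc≡+1 a) e)))
    ... | yes _ | no _ = ℕP.<-irrefl (sym e) (ℕP.≤-<-trans (ℕP.m∸n≤m a k) (ℕP.n<1+n a))
    ... | no _ | yes _ = ℕP.<-irrefl e (ℕP.≤-trans (s≤s z≤n) (ℕP.m≤n+m k a))
    ... | no np | no _ = k₁≢0 (sym (trans e (trans (cong (_∸ k) (last≡n₁ a lt np)) n₁∸k≡k₁)))

    prevᵢ≢oppᵢ : ∀ a → a < n → ¬ prevᵢ a ≡ oppᵢ a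
    prevᵢ≢oppᵢ zero lt e with 0 ℕ.<? k
    ... | yes _ = k₁≢0 (ℕP.+-cancelʳ-≡ (suc k₁) k₁ 0 e)
    ... | no np = np (s≤s z≤n)
    prevᵢ≢oppᵢ (suc a) lt e with suc a ℕ.<? k
    ... | yes _ = ℕP.<-irrefl e (ℕP.m≤m+n (suc a) k)
    ... | no np = k≢1 (ℕP.+-cancelˡ-≡ a k 1 (trans (cong (_+ k) e) (trans (ℕP.m∸n+n≡m (ℕP.≮⇒≥ np)) (sym (suc≡+1 a)))))

    Adj⇒neighbour : ∀ a b → a < n → b < n → Adj a b → b ≡ nextᵢ a ⊎ b ≡ prevᵢ a ⊎ b ≡ oppᵢ a
    Adj⇒neighbour a b la lb adj with ℕP.≤-total a b
    ... | inj₁ a≤b = caseL (b ∸ a) (sym (ℕP.m+[n∸m]≡n a≤b)) (subst Adj′ (ℕP.m≤n⇒∣m-n∣≡n∸m a≤b) adj)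
      where
      Adj′ : ℕ → Set
      Adj′ d = d ≡ 1 ⊎ d ≡ n ∸ 1 ⊎ d ≡ ⌊ n /2⌋
      caseL : ∀ d → b ≡ a + d → Adj′ d → b ≡ nextᵢ a ⊎ b ≡ prevᵢ a ⊎ b ≡ oppᵢ a
      caseL d eb (inj₁ d1) = inj₁ sres
        where
        bsa : b ≡ suc a
        bsa = trans eb (trans (cong (a +_) d1) (suc≡+1 a))
        sres : b ≡ nextᵢ a
        sres with suc a ℕ.<? n
        ... | yes _ = bsa
        ... | no np = ⊥-elim (np (subst (_< n) bsa lb))
      caseL d eb (inj₂ (inj₁ dn)) = inj₂ (inj₁ (subst (λ z → b ≡ prevᵢ z) (sym a0) (trans eb (trans (cong (_+ d) a0) dn))))
        where
        a0 : a ≡ 0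
        a0 = x+p<sp⇒x≡0 (subst (λ z → a + z < n) dn (subst (_< n) eb lb))
      caseL d eb (inj₂ (inj₂ dk)) = inj₂ (inj₂ ores)
        where
        bak : b ≡ a + k
        bak = trans eb (cong (a +_) (trans dk ⌊n/2⌋≡k))
        ak : a < k
        ak = ℕP.+-cancelʳ-< k a k (subst (_< n) bak lb)
        ores : b ≡ oppᵢ a
        ores with a ℕ.<? k
        ... | yes _ = bak
        ... | no np = ⊥-elim (np ak)
    ... | inj₂ b≤a = caseR (a ∸ b) (sym (ℕP.m+[n∸m]≡n b≤a)) (subst Adj′ (ℕP.m≤n⇒∣n-m∣≡n∸m b≤a) adj)
      where
      Adj′ : ℕ → Set
      Adj′ d = d ≡ 1 ⊎ d ≡ n ∸ 1 ⊎ d ≡ ⌊ n /2⌋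
      caseR : ∀ d → a ≡ b + d → Adj′ d → b ≡ nextᵢ a ⊎ b ≡ prevᵢ a ⊎ b ≡ oppᵢ a
      caseR d ea (inj₁ d1) = inj₂ (inj₁ (subst (λ z → b ≡ prevᵢ z) (sym (trans ea (trans (cong (b +_) d1) (suc≡+1 b)))) refl))
      caseR d ea (inj₂ (inj₁ dn)) = inj₁ sres
        where
        b0 : b ≡ 0
        b0 = x+p<sp⇒x≡0 (subst (λ z → b + z < n) dn (subst (_< n) ea la))
        an1 : a ≡ n₁
        an1 = trans ea (trans (cong (_+ d) b0) dn)
        sres : b ≡ nextᵢ a
        sres with suc a ℕ.<? n
        ... | yes p = ⊥-elim (ℕP.<-irrefl refl (subst (λ z → suc z < n) an1 p))
        ... | no _ = b0
      caseR d ea (inj₂ (inj₂ dk)) = inj₂ (inj₂ ores)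
        where
        abk : a ≡ b + k
        abk = trans ea (cong (b +_) (trans dk ⌊n/2⌋≡k))
        ores : b ≡ oppᵢ a
        ores with a ℕ.<? k
        ... | yes p = ⊥-elim (ℕP.<-irrefl refl (ℕP.≤-<-trans (ℕP.≤-trans (ℕP.m≤n+m k b) (ℕP.≤-reflexive (sym abk))) p))
        ... | no _ = sym (trans (cong (_∸ k) abk) (ℕP.m+n∸n≡m b k))

    nextᵢ-cases : ∀ d → d < n → (nextᵢ d ≡ suc d) ⊎ (d ≡ n₁ × nextᵢ d ≡ 0)
    nextᵢ-cases d lt with suc d ℕ.<? n
    ... | yes _ = inj₁ refl
    ... | no np = inj₂ (last≡n₁ d lt np , refl)

    oppᵢ-low : ∀ d → d < k → oppᵢ d ≡ d + k
    oppᵢ-low d lt with d ℕ.<? k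
    ... | yes _ = refl
    ... | no np = ⊥-elim (np lt)

    oppᵢ-high : ∀ d → ¬ d < k → oppᵢ d ≡ d ∸ k
    oppᵢ-high d nl with d ℕ.<? k
    ... | yes p = ⊥-elim (nl p)
    ... | no _ = refl

    module AtLeast8 (3≤k₁ : 3 ≤ k₁) where

      4≤k : 4 ≤ k
      4≤k = s≤s 3≤k₁

      8≤n : 8 ≤ n
      8≤n = ℕP.+-mono-≤ 4≤k 4≤k

      n₁+1≡n : n₁ + 1 ≡ n
      n₁+1≡n = ℕP.+-comm n₁ 1

      3≤6 : 3 ≤ 6
      3≤6 = s≤s (s≤s (s≤s z≤n))

      adj-cases : ∀ {d} → (d ≡ 1 ⊎ d ≡ n ∸ 1 ⊎ d ≡ ⌊ n /2⌋) → d ≡ 1 ⊎ d + 1 ≡ n ⊎ d ≡ k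
      adj-cases (inj₁ e) = inj₁ e
      adj-cases (inj₂ (inj₁ e)) = inj₂ (inj₁ (trans (cong (_+ 1) e) n₁+1≡n))
      adj-cases (inj₂ (inj₂ e)) = inj₂ (inj₂ (trans e ⌊n/2⌋≡k))

      not-adj : ∀ {d} c → 2 ≤ c → c ≤ 3 → (d ≡ c ⊎ d + c ≡ n) → ¬ (d ≡ 1 ⊎ d ≡ n ∸ 1 ⊎ d ≡ ⌊ n /2⌋)
      not-adj {d} c c2 c3 h a with adj-cases a | h
      ... | inj₁ e | inj₁ e2 = ℕP.<-irrefl (trans (sym e) e2) c2
      ... | inj₁ e | inj₂ e2 = ℕP.<-irrefl refl (ℕP.≤-trans
          (ℕP.≤-trans 8≤n (ℕP.≤-reflexive (trans (sym e2) (cong (_+ c) e)))) (s≤s (ℕP.≤-trans c3 3≤6)))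
      ... | inj₂ (inj₁ e) | inj₁ e2 = ℕP.<-irrefl refl (ℕP.≤-trans 8≤n
          (ℕP.≤-trans (ℕP.≤-reflexive (sym e)) (ℕP.+-monoˡ-≤ 1 (ℕP.≤-trans (ℕP.≤-reflexive e2) (ℕP.≤-trans c3 3≤6)))))
      ... | inj₂ (inj₁ e) | inj₂ e2 = ℕP.<-irrefl (ℕP.+-cancelˡ-≡ d 1 c (trans e (sym e2))) c2
      ... | inj₂ (inj₂ e) | inj₁ e2 = ℕP.<-irrefl refl (ℕP.≤-trans 4≤k (ℕP.≤-trans (ℕP.≤-reflexive (trans (sym e) e2)) c3))
      ... | inj₂ (inj₂ e) | inj₂ e2 = ℕP.<-irrefl refl (ℕP.≤-trans 4≤k
          (ℕP.≤-trans (ℕP.≤-reflexive (ℕP.+-cancelˡ-≡ k k c (trans (sym e2) (cong (_+ c) e)))) c3))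

      dd : ∀ x y → y ≤ x → ∣ x - y ∣ + y ≡ x
      dd x y le = trans (cong (_+ y) (ℕP.m≤n⇒∣n-m∣≡n∸m le)) (ℕP.m∸n+n≡m le)

      dd′ : ∀ x y → x ≤ y → ∣ x - y ∣ + x ≡ y
      dd′ x y le = trans (cong (_+ x) (ℕP.m≤n⇒∣m-n∣≡n∸m le)) (ℕP.m∸n+n≡m le)

      n₁≡suc : n₁ ≡ suc (k₁ + k₁)
      n₁≡suc = ℕP.+-suc k₁ k₁

      2≤k₁+k₁ : 2 ≤ k₁ + k₁
      2≤k₁+k₁ = ℕP.+-mono-≤ 1≤k₁ 1≤k₁

      data Pos (a : ℕ) : Set where
        mid : nextᵢ a ≡ suc a → nextᵢ (suc a) ≡ suc (suc a) → Pos a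
        pen : nextᵢ a ≡ suc a → suc a ≡ n₁ → nextᵢ (suc a) ≡ 0 → Pos a
        lst : a ≡ n₁ → nextᵢ a ≡ 0 → nextᵢ 0 ≡ 1 → Pos a

      pos : ∀ a → a < n → Pos a
      pos a lt with nextᵢ-cases a lt
      ... | inj₁ e with nextᵢ-cases (suc a) (subst (_< n) e (nextᵢ<n a))
      ...   | inj₁ e2 = mid e e2
      ...   | inj₂ (e2 , e3) = pen e e2 e3
      pos a lt | inj₂ (e , e1) with nextᵢ-cases 0 (s≤s z≤n)
      ...   | inj₁ e2 = lst e e1 e2
      ...   | inj₂ (e2 , _) = ⊥-elim (ℕP.<-irrefl (trans e2 n₁≡suc) (s≤s z≤n))

      Gap : ℕ → ℕ → Set
      Gap c d = d ≡ c ⊎ d + c ≡ n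

      dist2 : ∀ a → a < n → Gap 2 ∣ nextᵢ (nextᵢ a) - a ∣
      dist2 a lt with pos a lt
      ... | mid e e2 = inj₁ (trans (cong (λ z → ∣ nextᵢ z - a ∣) e)
          (trans (cong (λ z → ∣ z - a ∣) e2) (trans (cong (λ z → ∣ z - a ∣) (ℕP.+-comm 2 a)) (∣m+n-m∣≡n a 2))))
      ... | pen e e2 e3 = inj₂ (trans (cong (λ z → ∣ nextᵢ z - a ∣ + 2) e)
          (trans (cong (λ z → ∣ z - a ∣ + 2) e3) (trans (ℕP.+-comm a 2) (cong suc e2))))
      ... | lst e e1 e2 = inj₂ (trans (cong (λ z → ∣ nextᵢ z - a ∣ + 2) e1) (trans (cong (λ z → ∣ z - a ∣ + 2) e2)
                          (trans (cong (λ z → ∣ 1 - z ∣ + 2) e)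
                              (trans (sym (ℕP.+-assoc ∣ 1 - n₁ ∣ 1 1))
                              (trans (cong (_+ 1) (dd′ 1 n₁ (subst (1 ≤_) (sym n₁≡suc) (s≤s z≤n)))) n₁+1≡n)))))

      dist3 : ∀ a → a < n → Gap 3 ∣ prevᵢ a - nextᵢ (nextᵢ a) ∣
      dist3 a lt with pos a lt
      dist3 zero lt | mid e e2 = inj₂ (trans (cong (λ z → ∣ n₁ - nextᵢ z ∣ + 3) e) (trans (cong (λ z → ∣ n₁ - z ∣ + 3) e2)
                          (trans (sym (ℕP.+-assoc ∣ n₁ - 2 ∣ 2 1))
                              (trans (cong (_+ 1)
                              (dd n₁ 2 (subst (2 ≤_) (sym n₁≡suc) (s≤s (ℕP.≤-trans (s≤s z≤n) 2≤k₁+k₁))))) n₁+1≡n))))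
      dist3 (suc a) lt | mid e e2 = inj₁ (trans (cong (λ z → ∣ a - nextᵢ z ∣) e)
          (trans (cong (λ z → ∣ a - z ∣) e2) (trans (cong (λ z → ∣ a - z ∣) (ℕP.+-comm 3 a)) (ℕP.∣m-m+n∣≡n a 3))))
      dist3 zero lt | pen e e2 e3 = ⊥-elim (ℕP.<-irrefl (trans e2 n₁≡suc) (s≤s (ℕP.≤-trans (s≤s z≤n) 2≤k₁+k₁)))
      dist3 (suc a) lt | pen e e2 e3 = inj₂ (trans (cong (λ z → ∣ a - nextᵢ z ∣ + 3) e) (trans (cong (λ z → ∣ a - z ∣ + 3) e3)
                          (trans (cong (_+ 3) (ℕP.∣-∣-identityʳ a)) (trans (ℕP.+-comm a 3) (cong suc e2)))))
      dist3 a lt | lst e e1 e2 = inj₂ (trans (cong (λ z → ∣ prevᵢ a - nextᵢ z ∣ + 3) e1)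
          (trans (cong (λ z → ∣ prevᵢ a - z ∣ + 3) e2)
                          (trans (cong (λ z → ∣ prevᵢ z - 1 ∣ + 3) (trans e n₁≡suc))
                          (trans (sym (ℕP.+-assoc ∣ k₁ + k₁ - 1 ∣ 1 2))
                              (trans (cong (_+ 2) (dd (k₁ + k₁) 1 (ℕP.≤-trans (s≤s z≤n) 2≤k₁+k₁)))
                              (trans (ℕP.+-comm (k₁ + k₁) 2) (cong suc (sym n₁≡suc))))))))

      Gap≢0 : ∀ c → 2 ≤ c → c ≤ 3 → ¬ Gap c 0
      Gap≢0 c c2 c3 (inj₁ e) = ℕP.<-irrefl e (ℕP.≤-trans (s≤s z≤n) c2)
      Gap≢0 c c2 c3 (inj₂ e) = ℕP.<-irrefl refl (ℕP.≤-trans 8≤n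
          (ℕP.≤-trans (ℕP.≤-reflexive (sym e)) (ℕP.≤-trans c3 (s≤s (s≤s (s≤s z≤n))))))

      ¬Adj-next² : ∀ a → a < n → ¬ Adj (nextᵢ (nextᵢ a)) a
      ¬Adj-next² a lt = not-adj 2 (s≤s (s≤s z≤n)) (s≤s (s≤s z≤n)) (dist2 a lt)

      next²≢ᵢ : ∀ a → a < n → ¬ nextᵢ (nextᵢ a) ≡ a
      next²≢ᵢ a lt e = Gap≢0 2 (s≤s (s≤s z≤n)) (s≤s (s≤s z≤n)) (subst (Gap 2)
          (trans (cong (λ z → ∣ z - a ∣) e) (ℕP.∣n-n∣≡0 a)) (dist2 a lt))

      ¬Adj-prev-next² : ∀ a → a < n → ¬ Adj (prevᵢ a) (nextᵢ (nextᵢ a))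
      ¬Adj-prev-next² a lt = not-adj 3 (s≤s (s≤s z≤n)) ℕP.≤-refl (dist3 a lt)

      prevᵢ≢next²ᵢ : ∀ a → a < n → ¬ prevᵢ a ≡ nextᵢ (nextᵢ a)
      prevᵢ≢next²ᵢ a lt e = Gap≢0 3 (s≤s (s≤s z≤n)) ℕP.≤-refl (subst (Gap 3)
          (trans (cong (λ z → ∣ z - nextᵢ (nextᵢ a) ∣) e) (ℕP.∣n-n∣≡0 (nextᵢ (nextᵢ a)))) (dist3 a lt))

module HararyNeighbours where

  open import Defs
  open Laplacian
  open HararyIndices
  open import Data.Nat as ℕ using (ℕ; _∸_; ∣_-_∣; ⌊_/2⌋)
  open import Data.Fin as Fin using (Fin; toℕ; fromℕ<)
  import Data.Fin.Properties as FinP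
  open import Data.Integer as ℤ using (ℤ; +_; _+_; _-_; _*_)
  open import Data.Integer.Solver using (module +-*-Solver)
  open +-*-Solver
  open import Data.Sum using (inj₁; inj₂)
  open import Data.Empty using (⊥-elim)
  open import Function using (_∘_)
  open import Relation.Nullary using (yes; no; ¬_; Dec)
  open import Relation.Nullary.Decidable using (_⊎-dec_)
  open import Relation.Binary.PropositionalEquality

  module Harary (k₁ : ℕ) (1≤k₁ : 1 ℕ.≤ k₁) where
    open HararyIndex k₁ 1≤k₁ public

    G : Multigraph n
    G = HararyAdj n

    Adj? : ∀ a b → Dec (Adj a b)
    Adj? a b = (∣ a - b ∣ ℕ.≟ 1) ⊎-dec ((∣ a - b ∣ ℕ.≟ n ∸ 1) ⊎-dec (∣ a - b ∣ ℕ.≟ ⌊ n /2⌋))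

    G≡1 : ∀ v w → Adj (toℕ v) (toℕ w) → G v w ≡ 1
    G≡1 v w adj with Adj? (toℕ v) (toℕ w)
    ... | yes _   = refl
    ... | no ¬adj = ⊥-elim (¬adj adj)

    G≡0 : ∀ v w → ¬ Adj (toℕ v) (toℕ w) → G v w ≡ 0
    G≡0 v w ¬adj with Adj? (toℕ v) (toℕ w)
    ... | yes adj = ⊥-elim (¬adj adj)
    ... | no _    = refl

    undirected : Undirected G
    undirected v w = by-cases (Adj? (toℕ v) (toℕ w))
      where
      by-cases : Dec (Adj (toℕ v) (toℕ w)) → G v w ≡ G w v
      by-cases (yes adj) = trans (G≡1 v w adj) (sym (G≡1 w v (Adj-sym {toℕ v} adj)))
      by-cases (no ¬adj) = trans (G≡0 v w ¬adj) (sym (G≡0 w v (¬adj ∘ Adj-sym {toℕ w})))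

    loopless : Loopless G
    loopless v = G≡0 v v (Adj-irrefl (toℕ v))

    next prev opp : Fin n → Fin n
    next v = fromℕ< (nextᵢ<n (toℕ v))
    prev v = fromℕ< (prevᵢ<n (toℕ v) (FinP.toℕ<n v))
    opp  v = fromℕ< (oppᵢ<n (toℕ v) (FinP.toℕ<n v))

    toℕ-next : ∀ v → toℕ (next v) ≡ nextᵢ (toℕ v)
    toℕ-next v = FinP.toℕ-fromℕ< _
    toℕ-prev : ∀ v → toℕ (prev v) ≡ prevᵢ (toℕ v)
    toℕ-prev v = FinP.toℕ-fromℕ< _
    toℕ-opp : ∀ v → toℕ (opp v) ≡ oppᵢ (toℕ v)
    toℕ-opp v = FinP.toℕ-fromℕ< _

    G-next : ∀ v → G v (next v) ≡ 1
    G-next v = G≡1 v (next v) (subst (Adj (toℕ v)) (sym (toℕ-next v)) (Adj-next (toℕ v) (FinP.toℕ<n v)))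
    G-prev : ∀ v → G v (prev v) ≡ 1
    G-prev v = G≡1 v (prev v) (subst (Adj (toℕ v)) (sym (toℕ-prev v)) (Adj-prev (toℕ v)))
    G-opp : ∀ v → G v (opp v) ≡ 1
    G-opp v = G≡1 v (opp v) (subst (Adj (toℕ v)) (sym (toℕ-opp v)) (Adj-opp (toℕ v) (FinP.toℕ<n v)))

    G-prev⁻ : ∀ x → G (prev x) x ≡ 1
    G-prev⁻ x = trans (undirected (prev x) x) (G-prev x)

    G-opp⁻ : ∀ v → G (opp v) v ≡ 1
    G-opp⁻ v = trans (undirected (opp v) v) (G-opp v)

    adjacent⇒≢ : ∀ {a b} → G a b ≡ 1 → a ≢ b
    adjacent⇒≢ {a} Gab≡1 refl with trans (sym Gab≡1) (loopless a)
    ... | ()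

    private
      toℕ-≢ : ∀ {a b : Fin n} {x y} → toℕ a ≡ x → toℕ b ≡ y → x ≢ y → a ≢ b
      toℕ-≢ a≡x b≡y x≢y a≡b = x≢y (trans (sym a≡x) (trans (cong toℕ a≡b) b≡y))

    next≢prev : ∀ v → next v ≢ prev v
    next≢prev v = toℕ-≢ (toℕ-next v) (toℕ-prev v) (nextᵢ≢prevᵢ (toℕ v) (FinP.toℕ<n v))
    next≢opp : ∀ v → next v ≢ opp v
    next≢opp v = toℕ-≢ (toℕ-next v) (toℕ-opp v) (nextᵢ≢oppᵢ (toℕ v) (FinP.toℕ<n v))
    prev≢opp : ∀ v → prev v ≢ opp v
    prev≢opp v = toℕ-≢ (toℕ-prev v) (toℕ-opp v) (prevᵢ≢oppᵢ (toℕ v) (FinP.toℕ<n v))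

    +G≡χ : ∀ v w → + G v w ≡ χ (next v) w + χ (prev v) w + χ (opp v) w
    +G≡χ v w with next v FinP.≟ w
    ... | yes refl = begin
        + G v (next v)                  ≡⟨ cong +_ (G-next v) ⟩
        + 1 + + 0 + + 0                 ≡⟨ sym (cong₂ (λ a b → + 1 + a + b) (χ-diff (next≢prev v ∘ sym)) (χ-diff (next≢opp v ∘ sym))) ⟩
        + 1 + χ (prev v) (next v) + χ (opp v) (next v) ∎
      where open ≡-Reasoning
    ... | no ≢next with prev v FinP.≟ w
    ...   | yes refl = begin
        + G v (prev v)                  ≡⟨ cong +_ (G-prev v) ⟩
        + 0 + + 1 + + 0                 ≡⟨ sym (cong (λ b → + 0 + + 1 + b) (χ-diff (prev≢opp v ∘ sym))) ⟩
        + 0 + + 1 + χ (opp v) (prev v)  ∎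
      where open ≡-Reasoning
    ...   | no ≢prev with opp v FinP.≟ w
    ...     | yes refl = cong +_ (G-opp v)
    ...     | no ≢opp  = cong +_ (G≡0 v w ¬adj)
      where
      ¬adj : ¬ Adj (toℕ v) (toℕ w)
      ¬adj adj with Adj⇒neighbour (toℕ v) (toℕ w) (FinP.toℕ<n v) (FinP.toℕ<n w) adj
      ... | inj₁ e        = ≢next (FinP.toℕ-injective (trans (toℕ-next v) (sym e)))
      ... | inj₂ (inj₁ e) = ≢prev (FinP.toℕ-injective (trans (toℕ-prev v) (sym e)))
      ... | inj₂ (inj₂ e) = ≢opp  (FinP.toℕ-injective (trans (toℕ-opp v) (sym e)))

    sumFin-neighbours : ∀ v (h : Fin n → ℤ) → sumFin (λ w → + G v w * h w) ≡ h (next v) + h (prev v) + h (opp v)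
    sumFin-neighbours v h = begin
      sumFin (λ w → + G v w * h w)
        ≡⟨ sumFin-cong (λ w → trans (cong (_* h w) (+G≡χ v w)) (distrib (χ (next v) w) (χ (prev v) w) (χ (opp v) w) (h w))) ⟩
      sumFin (λ w → hχ (next v) w + hχ (prev v) w + hχ (opp v) w)
        ≡⟨ sumFin-+ (λ w → hχ (next v) w + hχ (prev v) w) (hχ (opp v)) ⟩
      sumFin (λ w → hχ (next v) w + hχ (prev v) w) + sumFin (hχ (opp v))
        ≡⟨ cong (_+ sumFin (hχ (opp v))) (sumFin-+ (hχ (next v)) (hχ (prev v))) ⟩
      sumFin (hχ (next v)) + sumFin (hχ (prev v)) + sumFin (hχ (opp v))
        ≡⟨ cong₂ _+_ (cong₂ _+_ (sumFin-*χ h (next v)) (sumFin-*χ h (prev v))) (sumFin-*χ h (opp v)) ⟩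
      h (next v) + h (prev v) + h (opp v)
        ∎
      where
      open ≡-Reasoning
      hχ : Fin n → Fin n → ℤ
      hχ a w = h w * χ a w
      distrib : ∀ a b c x → (a + b + c) * x ≡ x * a + x * b + x * c
      distrib = solve 4 (λ a b c x → (a :+ b :+ c) :* x := x :* a :+ x :* b :+ x :* c) refl

    Δ-Harary : ∀ f v → Δ G f v ≡ (f v - f (next v)) + (f v - f (prev v)) + (f v - f (opp v))
    Δ-Harary f v = sumFin-neighbours v (λ u → f v - f u)

module BooleanCycles where

  open import Data.Nat as ℕ using (ℕ; zero; suc; _+_; _≤_; _<_; z≤n; s≤s; _∸_)
  import Data.Nat.Properties as ℕP
  open import Data.Bool as Bool using (Bool; true; false)
  open import Data.Product using (∃; _×_; _,_; proj₁; proj₂)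
  open import Data.Sum using (_⊎_; inj₁; inj₂)
  open import Data.Empty using (⊥; ⊥-elim)
  open import Relation.Nullary using (yes; no; ¬_; Dec; ¬?)
  open import Relation.Nullary.Decidable using (decidable-stable)
  open import Relation.Binary.PropositionalEquality
  sumRange : (ℕ → ℕ) → ℕ → ℕ → ℕ
  sumRange g a zero = 0
  sumRange g a (suc m) = g a + sumRange g (suc a) m

  differ : Bool → Bool → ℕ
  differ true true = 0
  differ false false = 0
  differ true false = 1
  differ false true = 1

  differ-≢ : ∀ {b c} → ¬ b ≡ c → differ b c ≡ 1
  differ-≢ {true} {true} ne = ⊥-elim (ne refl)
  differ-≢ {true} {false} ne = refl
  differ-≢ {false} {true} ne = refl
  differ-≢ {false} {false} ne = ⊥-elim (ne refl)

  differ≡0⇒≡ : ∀ {b c} → differ b c ≡ 0 → b ≡ c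
  differ≡0⇒≡ {true} {true} e = refl
  differ≡0⇒≡ {false} {false} e = refl
  differ≡0⇒≡ {true} {false} ()
  differ≡0⇒≡ {false} {true} ()

  differ≤0⇒≡ : ∀ {b c} → differ b c ≤ 0 → b ≡ c
  differ≤0⇒≡ p = differ≡0⇒≡ (ℕP.n≤0⇒n≡0 p)

  ≢-≢⇒≡ : ∀ {a b c : Bool} → ¬ a ≡ b → ¬ c ≡ a → c ≡ b
  ≢-≢⇒≡ {true} {true} ne _ = ⊥-elim (ne refl)
  ≢-≢⇒≡ {true} {false} {true} _ ne2 = ⊥-elim (ne2 refl)
  ≢-≢⇒≡ {true} {false} {false} _ _ = refl
  ≢-≢⇒≡ {false} {true} {true} _ _ = refl
  ≢-≢⇒≡ {false} {true} {false} _ ne2 = ⊥-elim (ne2 refl)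
  ≢-≢⇒≡ {false} {false} ne _ = ⊥-elim (ne refl)

  sumRange-split : ∀ g a m1 2≤m → sumRange g a (m1 + 2≤m) ≡ sumRange g a m1 + sumRange g (a + m1) 2≤m
  sumRange-split g a zero 2≤m = cong (λ z → sumRange g z 2≤m) (sym (ℕP.+-identityʳ a))
  sumRange-split g a (suc m1) 2≤m = trans (cong (g a +_)
      (trans (sumRange-split g (suc a) m1 2≤m)
      (cong (λ z → sumRange g (suc a) m1 + sumRange g z 2≤m) (sym (ℕP.+-suc a m1))))) (sym (ℕP.+-assoc (g a) _ _))

  term≤sumRange : ∀ g a m d → d < m → g (a + d) ≤ sumRange g a m
  term≤sumRange g a (suc m) zero _ = subst (λ z → g z ≤ g a + sumRange g (suc a) m) (sym (ℕP.+-identityʳ a)) (ℕP.m≤m+n _ _)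
  term≤sumRange g a (suc m) (suc d) (s≤s p) = subst (λ z → g z ≤ g a + sumRange g (suc a) m) (sym
      (ℕP.+-suc a d)) (ℕP.≤-trans (term≤sumRange g (suc a) m d p) (ℕP.m≤n+m _ _))

  terms≤sumRange : ∀ g a m d1 d2 → d1 < m → d2 < m → ¬ d1 ≡ d2 → g (a + d1) + g (a + d2) ≤ sumRange g a m
  terms≤sumRange g a (suc m) zero zero _ _ ne = ⊥-elim (ne refl)
  terms≤sumRange g a (suc m) zero (suc d2) _ (s≤s p) _ = subst (λ z → g z + g (a + suc d2) ≤ g a + sumRange g
      (suc a) m) (sym (ℕP.+-identityʳ a))
    (ℕP.+-monoʳ-≤ (g a) (subst (λ z → g z ≤ sumRange g (suc a) m) (sym (ℕP.+-suc a d2)) (term≤sumRange g (suc a) m d2 p)))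
  terms≤sumRange g a (suc m) (suc d1) zero (s≤s p) _ _ = subst (λ z → g (a + suc d1) + g z ≤ g a + sumRange g
      (suc a) m) (sym (ℕP.+-identityʳ a))
    (subst (λ z → z ≤ g a + sumRange g (suc a) m) (ℕP.+-comm (g a) _)
        (ℕP.+-monoʳ-≤ (g a) (subst (λ z → g z ≤ sumRange g (suc a) m) (sym (ℕP.+-suc a d1)) (term≤sumRange g (suc a) m d1 p))))
  terms≤sumRange g a (suc m) (suc d1) (suc d2) (s≤s p) (s≤s q) ne = subst₂ (λ z1 z2 → g z1 + g z2 ≤ g a + sumRange g (suc a) m) (sym (ℕP.+-suc a d1)) (sym (ℕP.+-suc a d2))
    (ℕP.≤-trans (terms≤sumRange g (suc a) m d1 d2 p q (λ e → ne (cong suc e))) (ℕP.m≤n+m _ _))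

  sumRange-cong : ∀ {g h : ℕ → ℕ} a m → (∀ d → d < m → g (a + d) ≡ h (a + d)) → sumRange g a m ≡ sumRange h a m
  sumRange-cong a zero e = refl
  sumRange-cong {g} {h} a (suc m) e = cong₂ _+_ (trans (cong g (sym (ℕP.+-identityʳ a)))
      (trans (e 0 (s≤s z≤n)) (cong h (ℕP.+-identityʳ a))))
    (sumRange-cong (suc a) m
        (λ d lt → trans (cong g (sym (ℕP.+-suc a d))) (trans (e (suc d) (s≤s lt)) (cong h (ℕP.+-suc a d)))))

  sumRange-+ : ∀ (g h : ℕ → ℕ) a m → sumRange (λ i → g i + h i) a m ≡ sumRange g a m + sumRange h a m
  sumRange-+ g h a zero = refl
  sumRange-+ g h a (suc m) = trans (cong (g a + h a +_) (sumRange-+ g h (suc a) m)) (lem (g a) (h a) _ _)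
    where
    lem : ∀ p q r s → p + q + (r + s) ≡ p + r + (q + s)
    lem p q r s = trans (ℕP.+-assoc p q (r + s)) (trans
        (cong (p +_) (trans (sym (ℕP.+-assoc q r s))
        (trans (cong (_+ s) (ℕP.+-comm q r)) (ℕP.+-assoc r q s)))) (sym (ℕP.+-assoc p r (q + s))))

  sumRange-shift : ∀ (g : ℕ → ℕ) c a m → sumRange g (c + a) m ≡ sumRange (λ i → g (c + i)) a m
  sumRange-shift g c a zero = refl
  sumRange-shift g c a (suc m) = cong (g (c + a) +_) (trans (cong (λ z → sumRange g z m) (sym (ℕP.+-suc c a)))
      (sumRange-shift g c (suc a) m))

  leaves : Bool → Bool → ℕ
  leaves true false = 1
  leaves _ _ = 0

  differ≡leaves+leaves : ∀ b c → differ b c ≡ leaves b c + leaves c b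
  differ≡leaves+leaves true true = refl
  differ≡leaves+leaves true false = refl
  differ≡leaves+leaves false true = refl
  differ≡leaves+leaves false false = refl

  changes : (ℕ → Bool) → ℕ → ℕ
  changes x i = differ (x i) (x (suc i))

  1≤changes : ∀ x a m → ¬ x a ≡ x (a + m) → 1 ≤ sumRange (changes x) a m
  1≤changes x a zero ne = ⊥-elim (ne (cong x (sym (ℕP.+-identityʳ a))))
  1≤changes x a (suc m) ne with Bool._≟_ (x a) (x (suc a))
  ... | no d = subst (λ z → 1 ≤ z + sumRange (changes x) (suc a) m) (sym (differ-≢ d)) (s≤s z≤n)
  ... | yes e = ℕP.≤-trans (1≤changes x (suc a) m
      (λ e2 → ne (trans e (trans e2 (cong x (sym (ℕP.+-suc a m))))))) (ℕP.m≤n+m _ _)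

  changes≤0⇒constant : ∀ x a m → sumRange (changes x) a m ≤ 0 → ∀ d → d ≤ m → x (a + d) ≡ x a
  changes≤0⇒constant x a m p zero _ = cong x (ℕP.+-identityʳ a)
  changes≤0⇒constant x a (suc m) p (suc d) (s≤s q) = trans (cong x (ℕP.+-suc a d)) (trans
      (changes≤0⇒constant x (suc a) m (ℕP.m+n≤o⇒n≤o (changes x a) p) d q) (sym (differ≤0⇒≡ (ℕP.m+n≤o⇒m≤o (changes x a) p))))

  2≤changes : ∀ x m j → j ≤ m → ¬ x 0 ≡ x j → ¬ x j ≡ x m → 2 ≤ sumRange (changes x) 0 m
  2≤changes x m j le ne1 ne2 = subst (2 ≤_) (sym
      (trans (cong (sumRange (changes x) 0) (sym (ℕP.m+[n∸m]≡n le))) (sumRange-split (changes x) 0 j (m ∸ j))))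
    (ℕP.+-mono-≤ (1≤changes x 0 j ne1) (1≤changes x j (m ∸ j) (λ e → ne2 (trans e (cong x (ℕP.m+[n∸m]≡n le))))))

  4≰3 : ∀ {t} → 4 ≤ t → t ≤ 3 → ⊥
  4≰3 p q = ℕP.<-irrefl refl (ℕP.≤-trans p q)

  3≤1+1+1 : ∀ {a b c : ℕ} → 1 ≤ a → 1 ≤ b → 1 ≤ c → 3 ≤ a + b + c
  3≤1+1+1 p q r = ℕP.+-mono-≤ (ℕP.+-mono-≤ p q) r

  -- x and y are the two halves 0..m-1 and m..2m-1 of a 2-colouring of a 2m-cycle with the m chords
  -- i ~ i+m; x-end and y-end close the cycle.  X + Y counts the cycle edges joining different colours
  -- and C the chords that do.
  module CyclicPair (m : ℕ) (x y : ℕ → Bool) (2≤m : 2 ≤ m) (x-end : x m ≡ y 0) (y-end : y m ≡ x 0) where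

    X = sumRange (changes x) 0 m
    Y = sumRange (changes y) 0 m
    C = sumRange (λ i → differ (x i) (y i)) 0 m
    total = X + Y + C

    NonConstant : Set
    NonConstant = (∃ λ i → i < m × ¬ x i ≡ x 0) ⊎ (∃ λ i → i < m × ¬ y i ≡ x 0)

    AlmostConstantPair : Set
    AlmostConstantPair = (∃ λ j → j < m × ∃ λ c → (∀ i → i < m → ¬ i ≡ j → x i ≡ c) × (∀ i → i < m → y i ≡ c))
         ⊎ (∃ λ j → j < m × ∃ λ c → (∀ i → i < m → x i ≡ c) × (∀ i → i < m → ¬ i ≡ j → y i ≡ c))

    0<m : 0 < m
    0<m = ℕP.<-trans (s≤s z≤n) 2≤m

    Mismatch : Set
    Mismatch = ∃ λ j → j < m × ¬ x j ≡ y j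

    mismatch? : Mismatch ⊎ (∀ j → j < m → x j ≡ y j)
    mismatch? with ℕP.anyUpTo? (λ j → ¬? (x j Bool.≟ y j)) m
    ... | yes (j , j<m , x≢y) = inj₁ (j , j<m , x≢y)
    ... | no none             = inj₂ λ j j<m → decidable-stable (x j Bool.≟ y j) (λ x≢y → none (j , j<m , x≢y))

    no-mismatch⇒4≤total : (∀ j → j < m → x j ≡ y j) → NonConstant → 4 ≤ total
    no-mismatch⇒4≤total eq nc = ℕP.≤-trans (ℕP.+-mono-≤
        (2≤changes x m i (ℕP.<⇒≤ lt) (λ e → ne (sym e)) (λ e → ne (trans e (trans x-end (sym x₀≡y₀)))))
                                            (2≤changes y m i (ℕP.<⇒≤ lt)
                                                (λ e → ne (trans (eq i lt)
                                                (trans (sym e) (sym x₀≡y₀)))) (λ e → ne (trans (eq i lt) (trans e y-end)))))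
                              (ℕP.m≤m+n _ C)
      where
      x₀≡y₀ : x 0 ≡ y 0
      x₀≡y₀ = eq 0 0<m
      witness : NonConstant → ∃ λ i → i < m × ¬ x i ≡ x 0
      witness (inj₁ w) = w
      witness (inj₂ (i , lt , ne)) = i , lt , λ e → ne (trans (sym (eq i lt)) e)
      nonconstant = witness nc
      i = proj₁ nonconstant
      lt = proj₁ (proj₂ nonconstant)
      ne = proj₂ (proj₂ nonconstant)

    1≤C : Mismatch → 1 ≤ C
    1≤C (j , lt , ne) = subst (_≤ C) (differ-≢ ne) (term≤sumRange (λ i → differ (x i) (y i)) 0 m j lt)

    3≤total : NonConstant → 3 ≤ total
    3≤total nc with mismatch?
    ... | inj₂ eq = ℕP.≤-trans (ℕP.n≤1+n 3) (no-mismatch⇒4≤total eq nc)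
    ... | inj₁ (j , lt , ne) with Bool._≟_ (x 0) (y 0)
    ...   | no x₀≢y₀ = 3≤1+1+1 (1≤changes x 0 m (λ e → x₀≢y₀ (trans e x-end))) (1≤changes y 0 m
        (λ e → x₀≢y₀ (sym (trans e y-end)))) (1≤C (j , lt , ne))
    ...   | yes x₀≡y₀ with Bool._≟_ (x j) (x 0)
    ...     | yes ej = ℕP.+-mono-≤ {2} {X + Y} (ℕP.≤-trans
        (2≤changes y m j (ℕP.<⇒≤ lt) (λ e → ne (trans ej (trans x₀≡y₀ e)))
        (λ e → ne (trans ej (sym (trans e y-end))))) (ℕP.m≤n+m Y X)) (1≤C (j , lt , ne))
    ...     | no nej = ℕP.+-mono-≤ {2} {X + Y} (ℕP.≤-trans
        (2≤changes x m j (ℕP.<⇒≤ lt) (λ e → nej (sym e))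
        (λ e → nej (trans e (trans x-end (sym x₀≡y₀))))) (ℕP.m≤m+n X Y)) (1≤C (j , lt , ne))

    ≤1-from : ∀ {a} → (2 ≤ a → 4 ≤ total) → total ≤ 3 → a ≤ 1
    ≤1-from {a} f t with a ℕ.≤? 1
    ... | yes p = p
    ... | no np = ⊥-elim (4≰3 (f (ℕP.≰⇒> np)) t)

    ≤0-from : ∀ {a} → (1 ≤ a → 4 ≤ total) → total ≤ 3 → a ≤ 0
    ≤0-from {a} f t with a ℕ.≤? 0
    ... | yes p = p
    ... | no np = ⊥-elim (4≰3 (f (ℕP.≰⇒> np)) t)

    agree-off : C ≤ 1 → ∀ j → j < m → ¬ x j ≡ y j → ∀ i → i < m → ¬ i ≡ j → x i ≡ y i
    agree-off c1 j lj nej i li nij = differ≤0⇒≡ (ℕP.+-cancelˡ-≤ 1 _ _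
        (ℕP.≤-trans (subst (λ z → z + differ (x i) (y i) ≤ C) (differ-≢ nej)
        (terms≤sumRange (λ i → differ (x i) (y i)) 0 m j i lj li (λ e → nij (sym e)))) c1))

    total≤3⇒almostConstant : NonConstant → total ≤ 3 → AlmostConstantPair
    total≤3⇒almostConstant nc t with mismatch?
    ... | inj₂ eq = ⊥-elim (4≰3 (no-mismatch⇒4≤total eq nc) t)
    ... | inj₁ (j , lt , ne) with Bool._≟_ (x 0) (y 0)
    total≤3⇒almostConstant nc t | inj₁ (j , lt , ne) | no x₀≢y₀ = by-x₁ (Bool._≟_ (x 1) (x 0))
      where
      1≤X : 1 ≤ X
      1≤X = 1≤changes x 0 m (λ e → x₀≢y₀ (trans e x-end))
      1≤Y : 1 ≤ Y
      1≤Y = 1≤changes y 0 m (λ e → x₀≢y₀ (sym (trans e y-end)))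
      1≤C′ : 1 ≤ C
      1≤C′ = 1≤C (j , lt , ne)
      X≤1 : X ≤ 1
      X≤1 = ≤1-from (λ p → ℕP.+-mono-≤ (ℕP.+-mono-≤ p 1≤Y) 1≤C′) t
      Y≤1 : Y ≤ 1
      Y≤1 = ≤1-from (λ p → ℕP.+-mono-≤ (ℕP.+-mono-≤ 1≤X p) 1≤C′) t
      C≤1 : C ≤ 1
      C≤1 = ≤1-from (λ p → ℕP.+-mono-≤ (ℕP.+-mono-≤ 1≤X 1≤Y) p) t
      agree : ∀ i → i < m → ¬ i ≡ 0 → x i ≡ y i
      agree = agree-off C≤1 0 0<m x₀≢y₀
      m′ = m ∸ 1
      m≡1+m′ : m ≡ suc m′
      m≡1+m′ = sym (ℕP.suc-pred m {{ℕ.>-nonZero 0<m}})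
      constant-after-1 : ∀ (z : ℕ → Bool) → ¬ z 0 ≡ z 1 → sumRange (changes z) 0 m ≤ 1 → ∀ i → 1 ≤ i → i ≤ m → z i ≡ z 1
      constant-after-1 z nz le i 1i im = subst (λ w → z w ≡ z 1) (ℕP.m+[n∸m]≡n 1i) (changes≤0⇒constant z 1 m′
          (ℕP.+-cancelˡ-≤ 1 _ _
          (subst (_≤ 1)
          (trans (cong (λ w → sumRange (changes z) 0 w) m≡1+m′)
          (cong (λ w → w + sumRange (changes z) 1 m′) (differ-≢ nz))) le)) (i ∸ 1) (ℕP.∸-monoˡ-≤ 1 im))
      1<m : 1 < m
      1<m = 2≤m
      by-x₁ : Dec (x 1 ≡ x 0) → AlmostConstantPair
      by-x₁ (yes e1) = inj₂ (0 , 0<m , x 0 , xall , yrest)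
        where
        y1 : ¬ y 0 ≡ y 1
        y1 e = x₀≢y₀ (trans (sym e1) (trans (agree 1 1<m (λ ())) (sym e)))
        xall : ∀ i → i < m → x i ≡ x 0
        xall zero _ = refl
        xall (suc i) li = trans (agree (suc i) li (λ ())) (trans
            (constant-after-1 y y1 Y≤1 (suc i) (s≤s z≤n) (ℕP.<⇒≤ li)) (trans (sym (agree 1 1<m (λ ()))) e1))
        yrest : ∀ i → i < m → ¬ i ≡ 0 → y i ≡ x 0
        yrest zero _ nz = ⊥-elim (nz refl)
        yrest (suc i) li _ = trans (sym (agree (suc i) li (λ ()))) (xall (suc i) li)
      by-x₁ (no n1) = inj₁ (0 , 0<m , y 0 , xrest , yall)
        where
        x1 : ¬ x 0 ≡ x 1
        x1 e = n1 (sym e)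
        x1y0 : x 1 ≡ y 0
        x1y0 = ≢-≢⇒≡ x₀≢y₀ n1
        xrest : ∀ i → i < m → ¬ i ≡ 0 → x i ≡ y 0
        xrest zero _ nz = ⊥-elim (nz refl)
        xrest (suc i) li _ = trans (constant-after-1 x x1 X≤1 (suc i) (s≤s z≤n) (ℕP.<⇒≤ li)) x1y0
        yall : ∀ i → i < m → y i ≡ y 0
        yall zero _ = refl
        yall (suc i) li = trans (sym (agree (suc i) li (λ ()))) (xrest (suc i) li (λ ()))
    total≤3⇒almostConstant nc t | inj₁ (j , lt , ne) | yes x₀≡y₀ with Bool._≟_ (x j) (x 0)
    ... | yes ej = inj₂ (j , lt , x 0 , xall , yrest)
      where
      2≤Y : 2 ≤ Y
      2≤Y = 2≤changes y m j (ℕP.<⇒≤ lt) (λ e → ne (trans ej (trans x₀≡y₀ e))) (λ e → ne (trans ej (sym (trans e y-end))))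
      1≤C′ : 1 ≤ C
      1≤C′ = 1≤C (j , lt , ne)
      X≤1 : X ≤ 0
      X≤1 = ≤0-from (λ p → ℕP.+-mono-≤ (ℕP.+-mono-≤ p 2≤Y) 1≤C′) t
      C≤1 : C ≤ 1
      C≤1 = ≤1-from (λ p → ℕP.+-mono-≤ {2} {X + Y} (ℕP.≤-trans 2≤Y (ℕP.m≤n+m Y X)) p) t
      xall : ∀ i → i < m → x i ≡ x 0
      xall i li = changes≤0⇒constant x 0 m X≤1 i (ℕP.<⇒≤ li)
      yrest : ∀ i → i < m → ¬ i ≡ j → y i ≡ x 0
      yrest i li nij = trans (sym (agree-off C≤1 j lt ne i li nij)) (xall i li)
    ... | no nej = inj₁ (j , lt , x 0 , xrest , yall)
      where
      2≤X : 2 ≤ X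
      2≤X = 2≤changes x m j (ℕP.<⇒≤ lt) (λ e → nej (sym e)) (λ e → nej (trans e (trans x-end (sym x₀≡y₀))))
      1≤C′ : 1 ≤ C
      1≤C′ = 1≤C (j , lt , ne)
      Y≤1 : Y ≤ 0
      Y≤1 = ≤0-from (λ p → ℕP.+-mono-≤ (ℕP.+-mono-≤ 2≤X p) 1≤C′) t
      C≤1 : C ≤ 1
      C≤1 = ≤1-from (λ p → ℕP.+-mono-≤ {2} {X + Y} (ℕP.≤-trans 2≤X (ℕP.m≤m+n X Y)) p) t
      yall : ∀ i → i < m → y i ≡ x 0
      yall i li = trans (changes≤0⇒constant y 0 m Y≤1 i (ℕP.<⇒≤ li)) (sym x₀≡y₀)
      xrest : ∀ i → i < m → ¬ i ≡ j → x i ≡ x 0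
      xrest i li nij = trans (agree-off C≤1 j lt ne i li nij) (yall i li)

module HararyEdgeCuts where

  open import Defs
  open Laplacian
  open GonalityFromCuts using (Proper; AlmostConstant)
  open HararyIndices
  open HararyNeighbours
  open BooleanCycles
  open import Data.Nat as ℕ using (ℕ; zero; suc; _≤_; _<_; z≤n; s≤s; _∸_)
  import Data.Nat.Properties as ℕP
  open import Data.Fin as Fin using (Fin; toℕ; fromℕ<) renaming (zero to fz)
  import Data.Fin.Properties as FinP
  open import Data.Integer as ℤ using (ℤ; +_; _+_; _*_)
  import Data.Integer.Properties as ℤP
  open import Data.Product using (∃; _×_; _,_)
  open import Data.Sum using (_⊎_; inj₁; inj₂)
  open import Data.Bool as Bool using (Bool; true; false; if_then_else_; not; _∧_)
  open import Data.Empty using (⊥-elim)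
  open import Relation.Nullary using (yes; no; ¬_)
  open import Relation.Binary.PropositionalEquality

  sumFin≡sumRange : ∀ {m} (H : ℕ → ℕ) a → sumFin {m} (λ v → + H (a ℕ.+ toℕ v)) ≡ + sumRange H a m
  sumFin≡sumRange {zero} H a = refl
  sumFin≡sumRange {suc m} H a = trans (cong₂ _+_ (cong (λ z → + H z) (ℕP.+-identityʳ a))
      (trans (sumFin-cong {m} (λ v → cong (λ z → + H z) (ℕP.+-suc a (toℕ v)))) (sumFin≡sumRange {m} H (suc a)))) refl

  outside : Bool → ℤ
  outside b = if b then + 0 else + 1

  module HararyCuts (k₁ : ℕ) (1≤k₁ : 1 ≤ k₁) where
    open Harary k₁ 1≤k₁ public

    module _ (U : Fin n → Bool) where

      -- Indices ≥ n read U at vertex 0, so that ū n = ū 0 closes the cycle.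
      ū : ℕ → Bool
      ū i with i ℕ.<? n
      ... | yes p = U (fromℕ< p)
      ... | no _ = U fz

      ū-toℕ : ∀ v → ū (toℕ v) ≡ U v
      ū-toℕ v with toℕ v ℕ.<? n
      ... | yes p = cong U (FinP.fromℕ<-toℕ v p)
      ... | no np = ⊥-elim (np (FinP.toℕ<n v))

      ū-0 : ū 0 ≡ U fz
      ū-0 with 0 ℕ.<? n
      ... | yes p = refl
      ... | no np = ⊥-elim (np (s≤s z≤n))

      ū-n : ū n ≡ U fz
      ū-n with n ℕ.<? n
      ... | yes p = ⊥-elim (ℕP.<-irrefl refl p)
      ... | no np = refl

      exits : ℕ → ℕ
      exits i = leaves (ū i) (ū (nextᵢ i)) ℕ.+ leaves (ū i) (ū (prevᵢ i)) ℕ.+ leaves (ū i) (ū (oppᵢ i))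

      cut-row : ∀ v → sumFin (λ w → if U v ∧ not (U w) then + G v w else + 0) ≡ + exits (toℕ v)
      cut-row v = trans (by-neighbours (U v) refl) (row≡exits (U v) (ū-toℕ v))
        where
        by-neighbours : ∀ b → U v ≡ b → sumFin (λ w → if b ∧ not
            (U w) then + G v w else + 0) ≡ (if b then outside (U (next v)) + outside (U (prev v)) + outside (U
            (opp v)) else + 0)
        by-neighbours true _ = trans (sumFin-cong {n} {g = λ w → + G v w * outside (U w)}
            (λ w → outside-weight (U w))) (sumFin-neighbours v (λ w → outside (U w)))
          where
          outside-weight : ∀ {w} b → (if not b then + G v w else + 0) ≡ + G v w * outside b
          outside-weight {w} true = sym (ℤP.*-zeroʳ (+ G v w))
          outside-weight {w} false = sym (ℤP.*-identityʳ (+ G v w))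
        by-neighbours false _ = sumFin-zero n
        outside≡leaves : ∀ b c → (if b then outside c else + 0) ≡ + leaves b c
        outside≡leaves true true = refl
        outside≡leaves true false = refl
        outside≡leaves false true = refl
        outside≡leaves false false = refl
        row≡exits : ∀ b → ū (toℕ v) ≡ b → (if b then outside (U (next v)) + outside (U (prev v)) + outside
            (U (opp v)) else + 0) ≡ + exits (toℕ v)
        row≡exits b e = trans (sum-outside b (U (next v)) (U (prev v)) (U (opp v)))
          (cong +_ (cong₂ ℕ._+_ (cong₂ ℕ._+_ (cong₂ leaves (sym e) (trans (sym (ū-toℕ (next v))) (cong ū (toℕ-next v))))
                                        (cong₂ leaves (sym e) (trans (sym (ū-toℕ (prev v))) (cong ū (toℕ-prev v)))))
                              (cong₂ leaves (sym e) (trans (sym (ū-toℕ (opp v))) (cong ū (toℕ-opp v))))))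
          where
          sum-outside : ∀ b c d f → (if b then outside c + outside d + outside f else + 0) ≡ + (leaves b c ℕ.+ leaves b d ℕ.+ leaves b f)
          sum-outside true c d f = trans (cong₂ _+_ (cong₂ _+_ (outside≡leaves true c) (outside≡leaves true d))
              (outside≡leaves true f)) refl
          sum-outside false c d f = refl

      cut≡exits : cut G U ≡ + sumRange exits 0 n
      cut≡exits = trans (sumFin-cong cut-row) (sumFin≡sumRange {n} exits 0)

      ū⁺ : ℕ → Bool
      ū⁺ i = ū (k ℕ.+ i)

      ū-k : ū k ≡ ū⁺ 0
      ū-k = cong ū (sym (ℕP.+-identityʳ k))

      ū⁺-k : ū⁺ k ≡ ū 0
      ū⁺-k = trans ū-n (sym ū-0)

      open CyclicPair k ū ū⁺ 2≤k ū-k ū⁺-k public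

      up : ℕ → ℕ
      up i = leaves (ū i) (ū (suc i))
      down : ℕ → ℕ
      down i = leaves (ū (suc i)) (ū i)
      exits-next : ℕ → ℕ
      exits-next i = leaves (ū i) (ū (nextᵢ i))
      exits-prev : ℕ → ℕ
      exits-prev i = leaves (ū i) (ū (prevᵢ i))
      exits-opp : ℕ → ℕ
      exits-opp i = leaves (ū i) (ū (oppᵢ i))

      exits-next≡up : sumRange exits-next 0 n ≡ sumRange up 0 n
      exits-next≡up = sumRange-cong 0 n (λ d lt → cong (leaves (ū d)) (ū-next d lt))
        where
        ū-next : ∀ d → d < n → ū (nextᵢ d) ≡ ū (suc d)
        ū-next d lt with nextᵢ-cases d lt
        ... | inj₁ e = cong ū e
        ... | inj₂ (e1 , e2) = trans (cong ū e2) (trans ū-0 (sym (trans (cong (λ z → ū (suc z)) e1) ū-n)))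

      exits-prev≡down : sumRange exits-prev 0 n ≡ sumRange down 0 n
      exits-prev≡down = trans (cong (exits-prev 0 ℕ.+_) (sumRange-shift exits-prev 1 0 n₁))
           (trans (ℕP.+-comm (exits-prev 0) _)
           (trans (cong (sumRange down 0 n₁ ℕ.+_)
               (trans (cong₂ leaves (trans ū-0 (sym ū-n)) refl) (sym (ℕP.+-identityʳ (down n₁)))))
           (trans (sym (sumRange-split down 0 n₁ 1)) (cong (sumRange down 0) (ℕP.+-comm n₁ 1)))))

      up+down≡changes : sumRange up 0 n ℕ.+ sumRange down 0 n ≡ sumRange (changes ū) 0 n
      up+down≡changes = trans (sym (sumRange-+ up down 0 n)) (sumRange-cong 0 n
          (λ d _ → sym (differ≡leaves+leaves (ū d) (ū (suc d)))))

      changes≡X+Y : sumRange (changes ū) 0 n ≡ X ℕ.+ Y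
      changes≡X+Y = trans (sumRange-split (changes ū) 0 k k) (cong (X ℕ.+_)
          (trans (cong (λ z → sumRange (changes ū) z k) (sym (ℕP.+-identityʳ k)))
             (trans (sumRange-shift (changes ū) k 0 k)
                 (sumRange-cong 0 k (λ d _ → cong (λ z → differ (ū⁺ d) (ū z)) (sym (ℕP.+-suc k d)))))))

      exits-opp≡C : sumRange exits-opp 0 n ≡ C
      exits-opp≡C = trans (sumRange-split exits-opp 0 k k) (trans
          (cong₂ ℕ._+_ low-half
          (trans (cong (λ z → sumRange exits-opp z k) (sym (ℕP.+-identityʳ k)))
          (trans (sumRange-shift exits-opp k 0 k) high-half)))
             (trans (sym (sumRange-+ (λ i → leaves (ū i) (ū⁺ i)) (λ i → leaves (ū⁺ i) (ū i)) 0 k))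
                 (sumRange-cong 0 k (λ d _ → sym (differ≡leaves+leaves (ū d) (ū⁺ d))))))
        where
        ū-opp-low : ∀ d → d < k → ū (oppᵢ d) ≡ ū⁺ d
        ū-opp-low d lt = cong ū (trans (oppᵢ-low d lt) (ℕP.+-comm d k))
        low-half : sumRange exits-opp 0 k ≡ sumRange (λ i → leaves (ū i) (ū⁺ i)) 0 k
        low-half = sumRange-cong 0 k (λ d lt → cong (leaves (ū d)) (ū-opp-low d lt))
        ū-opp-high : ∀ d → ū (oppᵢ (k ℕ.+ d)) ≡ ū d
        ū-opp-high d = cong ū (trans
            (oppᵢ-high (k ℕ.+ d) (λ p → ℕP.<-irrefl refl (ℕP.≤-<-trans (ℕP.m≤m+n k d) p))) (ℕP.m+n∸m≡n k d))
        high-half : sumRange (λ i → exits-opp (k ℕ.+ i)) 0 k ≡ sumRange (λ i → leaves (ū⁺ i) (ū i)) 0 k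
        high-half = sumRange-cong 0 k (λ d lt → cong (leaves (ū⁺ d)) (ū-opp-high d))

      exits≡total : sumRange exits 0 n ≡ total
      exits≡total = trans (sumRange-+ (λ i → exits-next i ℕ.+ exits-prev i) exits-opp 0 n) (cong₂ ℕ._+_
          (trans (sumRange-+ exits-next exits-prev 0 n)
          (trans (cong₂ ℕ._+_ exits-next≡up exits-prev≡down) (trans up+down≡changes changes≡X+Y))) exits-opp≡C)

      cut≡total : cut G U ≡ + total
      cut≡total = trans cut≡exits (cong +_ exits≡total)

    f≢t : ¬ false ≡ true
    f≢t ()

    split-index : ∀ i → i < n → (i < k) ⊎ (∃ λ j → j < k × i ≡ k ℕ.+ j)
    split-index i lt with i ℕ.<? k
    ... | yes p = inj₁ p
    ... | no np = inj₂ (i ∸ k , ℕP.+-cancelˡ-< k (i ∸ k) k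
        (subst (_< n) (sym (ℕP.m+[n∸m]≡n (ℕP.≮⇒≥ np))) lt) , sym (ℕP.m+[n∸m]≡n (ℕP.≮⇒≥ np)))

    nonconst : ∀ (U : Fin n → Bool) v → ¬ U v ≡ ū U 0 → NonConstant U
    nonconst U v ne with split-index (toℕ v) (FinP.toℕ<n v)
    ... | inj₁ lt = inj₁ (toℕ v , lt , λ e → ne (trans (sym (ū-toℕ U v)) e))
    ... | inj₂ (j , lt , e) = inj₂ (j , lt , λ e2 → ne (trans (sym (ū-toℕ U v)) (trans (cong (ū U) e) e2)))

    proper⇒nonConstant : ∀ (U : Fin n → Bool) → Proper U → NonConstant U
    proper⇒nonConstant U ((v₁ , U₁) , (v₀ , U₀)) with ū U 0 Bool.≟ true
    ... | yes t = nonconst U v₀ (λ e → f≢t (trans (sym U₀) (trans e t)))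
    ... | no nt = nonconst U v₁ (λ e → nt (trans (sym e) U₁))

    cut≥3 : ∀ U → Proper U → + 3 ℤ.≤ cut G U
    cut≥3 U proper = subst (+ 3 ℤ.≤_) (sym (cut≡total U)) (ℤ.+≤+ (3≤total U (proper⇒nonConstant U proper)))

    cut≤3⇒almostConstant : ∀ U → Proper U → cut G U ℤ.≤ + 3 → AlmostConstant U
    cut≤3⇒almostConstant U proper le with total≤3⇒almostConstant U (proper⇒nonConstant U proper) (ℤP.drop‿+≤+
        (subst (ℤ._≤ + 3) (cut≡total U) le))
    ... | inj₁ (j , lt , c , xr , ya) = fromℕ< (ℕP.<-trans lt k<n) , c , res
      where
      res : ∀ v → ¬ v ≡ fromℕ< (ℕP.<-trans lt k<n) → U v ≡ c
      res v nz with split-index (toℕ v) (FinP.toℕ<n v)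
      ... | inj₁ l = trans (sym (ū-toℕ U v)) (xr (toℕ v) l (λ e → nz (FinP.toℕ-injective (trans e (sym (FinP.toℕ-fromℕ< _))))))
      ... | inj₂ (i , l , e) = trans (sym (ū-toℕ U v)) (trans (cong (ū U) e) (ya i l))
    ... | inj₂ (j , lt , c , xa , yr) = fromℕ< (ℕP.+-monoʳ-< k lt) , c , res
      where
      res : ∀ v → ¬ v ≡ fromℕ< (ℕP.+-monoʳ-< k lt) → U v ≡ c
      res v nz with split-index (toℕ v) (FinP.toℕ<n v)
      ... | inj₁ l = trans (sym (ū-toℕ U v)) (xa (toℕ v) l)
      ... | inj₂ (i , l , e) = trans (sym (ū-toℕ U v)) (trans (cong (ū U) e)
          (yr i l (λ ij → nz
          (FinP.toℕ-injective (trans e (trans (cong (k ℕ.+_) ij) (sym (FinP.toℕ-fromℕ< (ℕP.+-monoʳ-< k lt)))))))))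

module HararyGonality≥4 where

  open import Defs
  open Laplacian
  open GonalityFromCuts
  open HararyIndices
  open HararyNeighbours
  open HararyEdgeCuts
  open import Data.Nat as ℕ using (ℕ; zero; suc; z≤n; s≤s)
  import Data.Nat.Properties as ℕP
  open import Data.Fin as Fin using (Fin; toℕ; _↑ˡ_; _↑ʳ_)
  import Data.Fin.Properties as FinP
  open import Data.Integer as ℤ using (ℤ; +_; _+_; _*_; _≤_; +≤+)
  import Data.Integer.Properties as ℤP
  open import Data.Product using (_,_)
  open import Data.Sum using (inj₁; inj₂)
  open import Data.Empty using (⊥; ⊥-elim)
  open import Function using (_∘_)
  open import Relation.Nullary using (yes; no; ¬_)
  open import Relation.Binary.PropositionalEquality

  module Gonality≥4 (k₁ : ℕ) (1≤k₁ : 1 ℕ.≤ k₁) (3≤k₁ : 3 ℕ.≤ k₁) where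
    open Harary k₁ 1≤k₁
    open HararyCuts k₁ 1≤k₁ using (cut≥3; cut≤3⇒almostConstant)
    open AtLeast8 3≤k₁

    private
      lt : ∀ (v : Fin n) → toℕ v ℕ.< n
      lt = FinP.toℕ<n

      toℕ-next² : ∀ x → toℕ (next (next x)) ≡ nextᵢ (nextᵢ (toℕ x))
      toℕ-next² x = trans (toℕ-next (next x)) (cong nextᵢ (toℕ-next x))

    G-next²≡0 : ∀ x → G (next (next x)) x ≡ 0
    G-next²≡0 x = G≡0 _ x (¬Adj-next² (toℕ x) (lt x) ∘ subst (λ a → Adj a (toℕ x)) (toℕ-next² x))

    next²≢ : ∀ x → next (next x) ≢ x
    next²≢ x e = next²≢ᵢ (toℕ x) (lt x) (trans (sym (toℕ-next² x)) (cong toℕ e))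

    G-prev-next²≡0 : ∀ x → G (prev x) (next (next x)) ≡ 0
    G-prev-next²≡0 x = G≡0 _ _ (¬Adj-prev-next² (toℕ x) (lt x) ∘ subst₂ Adj (toℕ-prev x) (toℕ-next² x))

    prev≢next² : ∀ x → prev x ≢ next (next x)
    prev≢next² x e = prevᵢ≢next²ᵢ (toℕ x) (lt x) (trans (sym (toℕ-prev x)) (trans (cong toℕ e) (toℕ-next² x)))

    opp-↑ˡ : ∀ i → opp (i ↑ˡ k) ≡ k ↑ʳ i
    opp-↑ˡ i = FinP.toℕ-injective (begin
      toℕ (opp (i ↑ˡ k))      ≡⟨ trans (toℕ-opp (i ↑ˡ k)) (cong oppᵢ (FinP.toℕ-↑ˡ i k)) ⟩
      oppᵢ (toℕ i)            ≡⟨ oppᵢ-low (toℕ i) (FinP.toℕ<n i) ⟩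
      toℕ i ℕ.+ k             ≡⟨ ℕP.+-comm (toℕ i) k ⟩
      k ℕ.+ toℕ i             ≡⟨ sym (FinP.toℕ-↑ʳ k i) ⟩
      toℕ (k ↑ʳ i)            ∎)
      where open ≡-Reasoning

    private
      +-cancel-≤0 : ∀ {a b : ℤ} → a + b ≤ a → b ≤ + 0
      +-cancel-≤0 {a} {b} a+b≤a = subst₂ _≤_ (solve 2 (λ a b → a :+ b :+ :- a := b) refl a b)
                                            (solve 1 (λ a → a :+ :- a := con (+ 0)) refl a)
                                            (ℤP.+-monoˡ-≤ (ℤ.- a) a+b≤a)
        where open import Data.Integer.Solver using (module +-*-Solver)
              open +-*-Solver

    module _ {d} (rep : PositiveRankRep G d) (d≤3 : d ≤ + 3) where
      open PositiveRankRep rep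

      private
        shape-at : ∀ q → D₀ q ≡ + 0 → Shape G 3 D₀ q
        shape-at = rep-shape undirected 3 cut≥3 cut≤3⇒almostConstant rep d≤3

        deg≤3 : deg D₀ ≤ + 3
        deg≤3 = subst (_≤ + 3) (sym deg-D₀) d≤3

      no-vertex-with-3 : ∀ x → + 3 ≤ D₀ x → ⊥
      no-vertex-with-3 x 3≤D₀x = excluded (shape-at q D₀q≡0)
        where
        q = next (next x)
        D₀x≢0 : D₀ x ≢ + 0
        D₀x≢0 D₀x≡0 = 1≰0 (ℤP.≤-trans (+≤+ (s≤s z≤n)) (subst (+ 3 ≤_) D₀x≡0 3≤D₀x))
        D₀q≡0 : D₀ q ≡ + 0
        D₀q≡0 = ℤP.≤-antisym (+-cancel-≤0 (ℤP.≤-trans (two-terms≤sumFin D₀-effective (next²≢ x ∘ sym))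
                                                     (ℤP.≤-trans deg≤3 3≤D₀x)))
                             (D₀-effective q)
        only-x : ∀ {x′} → (∀ v → v ≢ x′ → D₀ v ≡ + 0) → x ≡ x′
        only-x {x′} off with x FinP.≟ x′
        ... | yes x≡x′ = x≡x′
        ... | no x≢x′  = ⊥-elim (D₀x≢0 (off x x≢x′))
        excluded : Shape G 3 D₀ q → ⊥
        excluded (concentrated x′ _ off (inj₁ 1≤Gqx′)) with only-x off
        ... | refl = ℕP.<-irrefl (sym (G-next²≡0 x)) 1≤Gqx′
        excluded (concentrated x′ _ off (inj₂ bridged)) with only-x off
        ... | refl = ℕP.<-irrefl (sym (G-prev-next²≡0 x))
                       (bridged (prev x) (adjacent⇒≢ (G-prev⁻ x)) (prev≢next² x) (ℕP.≤-reflexive (sym (G-prev⁻ x))))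
        excluded (spread m _ D₀≡) = D₀x≢0 (begin
          D₀ x                ≡⟨ D₀≡ x (next²≢ x ∘ sym) ⟩
          m * + G x q         ≡⟨ cong (λ g → m * + g) (trans (undirected x q) (G-next²≡0 x)) ⟩
          m * + 0             ≡⟨ ℤP.*-zeroʳ m ⟩
          + 0                 ∎)
          where open ≡-Reasoning

      module _ (small : ∀ x → ¬ + 3 ≤ D₀ x) where

        opposite-pair≥1 : ∀ v → + 1 ≤ D₀ v + D₀ (opp v)
        opposite-pair≥1 v with D₀ v ℤ.≟ + 0 | D₀ (opp v) ℤ.≟ + 0
        ... | no D₀v≢0 | _ = ℤP.≤-trans (nonzero⇒≥1 (D₀-effective v) D₀v≢0)
                               (ℤP.i≤i+j (D₀ v) (D₀ (opp v)) {{ℤ.nonNegative (D₀-effective (opp v))}})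
        ... | yes _ | no D₀o≢0 = ℤP.≤-trans (nonzero⇒≥1 (D₀-effective (opp v)) D₀o≢0)
                                   (ℤP.i≤j+i (D₀ (opp v)) (D₀ v) {{ℤ.nonNegative (D₀-effective v)}})
        ... | yes D₀v≡0 | yes D₀o≡0 = ⊥-elim (excluded (shape-at v D₀v≡0))
          where
          open ≡-Reasoning
          excluded : Shape G 3 D₀ v → ⊥
          excluded (concentrated x′ 3≤D₀x′ _ _) = small x′ 3≤D₀x′
          excluded (spread m 1≤m D₀≡) = 1≰0 (ℤP.≤-trans 1≤m (ℤP.≤-reflexive (begin
            m                   ≡⟨ sym (ℤP.*-identityʳ m) ⟩
            m * + 1             ≡⟨ cong (λ g → m * + g) (sym (G-opp⁻ v)) ⟩
            m * + G (opp v) v   ≡⟨ sym (D₀≡ (opp v) (adjacent⇒≢ (G-opp⁻ v))) ⟩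
            D₀ (opp v)          ≡⟨ D₀o≡0 ⟩
            + 0                 ∎)))

        k≤deg : + k ≤ deg D₀
        k≤deg = begin
          + k                                                            ≤⟨ n≤sumFin {k} pair≥1 ⟩
          sumFin {k} (λ i → D₀ (i ↑ˡ k) + D₀ (k ↑ʳ i))                    ≡⟨ sumFin-+ {k} (λ i → D₀ (i ↑ˡ k)) (λ i → D₀ (k ↑ʳ i)) ⟩
          sumFin {k} (λ i → D₀ (i ↑ˡ k)) + sumFin {k} (λ i → D₀ (k ↑ʳ i)) ≡⟨ sym (sumFin-↑ k {k} D₀) ⟩
          deg D₀                                                         ∎
          where
          open ℤP.≤-Reasoning
          pair≥1 : ∀ i → + 1 ≤ D₀ (i ↑ˡ k) + D₀ (k ↑ʳ i)
          pair≥1 i = subst (λ w → + 1 ≤ D₀ (i ↑ˡ k) + D₀ w) (opp-↑ˡ i) (opposite-pair≥1 (i ↑ˡ k))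

      absurd : ⊥
      absurd with FinP.any? (λ x → + 3 ℤ.≤? D₀ x)
      ... | yes (x , 3≤D₀x) = no-vertex-with-3 x 3≤D₀x
      ... | no none         = ℕP.<-irrefl refl (ℕP.≤-trans (s≤s (s≤s (s≤s (s≤s z≤n)))) (ℕP.≤-trans 4≤k
                                (ℤP.drop‿+≤+ (ℤP.≤-trans (k≤deg (λ x 3≤D₀x → none (x , 3≤D₀x))) deg≤3))))

    rep-deg≥4 : ∀ {d} → PositiveRankRep G d → + 4 ≤ d
    rep-deg≥4 {d} rep with + 4 ℤ.≤? d
    ... | yes 4≤d = 4≤d
    ... | no 4≰d  = ⊥-elim (absurd rep (ℤP.i<j⇒i≤pred[j] (ℤP.≰⇒> 4≰d)))

module RungCycle where

  open HararyIndices
  open import Data.Nat as ℕ using (ℕ; zero; suc; _+_; _*_; _≤_; _<_; z≤n; s≤s; _∸_)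
  import Data.Nat.Properties as ℕP
  open import Data.Sum using (_⊎_; inj₁; inj₂)
  open import Data.Product using (_×_; _,_)
  open import Data.Empty using (⊥-elim)
  open import Relation.Nullary using (yes; no; ¬_; Dec)
  open import Relation.Binary.PropositionalEquality
  import Data.Nat.Solver
  private
    module NS = Data.Nat.Solver.+-*-Solver
    open NS using (con; _:+_; _:*_; _:=_)

  δℕ : ℕ → ℕ → ℕ
  δℕ zero zero = 1
  δℕ zero (suc _) = 0
  δℕ (suc _) zero = 0
  δℕ (suc x) (suc y) = δℕ x y

  δℕ-refl : ∀ x → δℕ x x ≡ 1
  δℕ-refl zero = refl
  δℕ-refl (suc x) = δℕ-refl x

  δℕ-≢ : ∀ {x y} → ¬ x ≡ y → δℕ x y ≡ 0
  δℕ-≢ {zero} {zero} ne = ⊥-elim (ne refl)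
  δℕ-≢ {zero} {suc y} ne = refl
  δℕ-≢ {suc x} {zero} ne = refl
  δℕ-≢ {suc x} {suc y} ne = δℕ-≢ (λ e → ne (cong suc e))

  second-difference : ∀ a y → (a ∸ y) + (a ∸ suc (suc y)) ≡ 2 * (a ∸ suc y) + δℕ (suc y) a
  second-difference zero y = trans (ℕP.+-identityʳ (0 ∸ y)) (ℕP.0∸n≡0 y)
  second-difference (suc zero) zero = refl
  second-difference (suc (suc b)) zero = NS.solve 1 (λ b → (con 2 :+ b) :+ b := con 2 :* (con 1 :+ b) :+ con 0) refl b
  second-difference (suc a) (suc y) = second-difference a y

  ∸-suc : ∀ k ρ → ρ < k → k ∸ ρ ≡ suc (k ∸ suc ρ)
  ∸-suc (suc k) zero _ = refl
  ∸-suc (suc k) (suc ρ) (s≤s lt) = ∸-suc k ρ lt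

  nextᶜ : ℕ → ℕ → ℕ
  nextᶜ k ρ with suc ρ ℕ.<? k
  ... | yes _ = suc ρ
  ... | no _ = 0

  prevᶜ : ℕ → ℕ → ℕ
  prevᶜ k zero = k ∸ 1
  prevᶜ k (suc ρ) = ρ

  -- On the k-cycle, 2·[0] − Δ tent = [a] + [k − a] (tent-balance): two chips at 0 can be moved to a and k − a.
  module Tent (k a : ℕ) (1≤a : 1 ≤ a) (a+a≤k : a + a ≤ k) where

    tent : ℕ → ℕ
    tent ρ = (a ∸ ρ) + (a ∸ (k ∸ ρ))

    a<k : a < k
    a<k = ℕP.<-≤-trans (ℕP.m<m+n a 1≤a) a+a≤k

    combine : ∀ A0 A1 A2 B0 B1 B2 i1 i2 → A1 + A2 ≡ 2 * A0 + i1 → B1 + B2 ≡ 2 * B0 + i2 → (A1 + B1) + (A2 + B2) ≡ 2 * (A0 + B0) + i1 + i2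
    combine A0 A1 A2 B0 B1 B2 i1 i2 ea eb = trans (NS.solve 4
        (λ A1 A2 B1 B2 → (A1 :+ B1) :+ (A2 :+ B2) := (A1 :+ A2) :+ (B1 :+ B2)) refl A1 A2 B1 B2)
      (trans (cong₂ _+_ ea eb)
          (NS.solve 4 (λ A0 B0 i1 i2 → (con 2 :* A0 :+ i1) :+ (con 2 :* B0 :+ i2) := con 2 :*
          (A0 :+ B0) :+ i1 :+ i2) refl A0 B0 i1 i2))

    tent-interior : ∀ ρ → suc ρ < k → tent ρ + tent (suc (suc ρ)) ≡ 2 * tent (suc ρ) + δℕ (suc ρ) a + δℕ (k ∸ suc ρ) a
    tent-interior ρ lt = combine (a ∸ suc ρ) (a ∸ ρ) (a ∸ suc (suc ρ)) (a ∸ (k ∸ suc ρ)) (a ∸ (k ∸ ρ)) (a ∸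
        (k ∸ suc (suc ρ))) (δℕ (suc ρ) a) (δℕ (k ∸ suc ρ) a) (second-difference a ρ) bpart
      where
      m = k ∸ suc (suc ρ)
      e1 : k ∸ suc ρ ≡ suc m
      e1 = ∸-suc k (suc ρ) lt
      e0 : k ∸ ρ ≡ suc (suc m)
      e0 = trans (∸-suc k ρ (ℕP.<-trans (ℕP.n<1+n ρ) lt)) (cong suc e1)
      bpart : (a ∸ (k ∸ ρ)) + (a ∸ (k ∸ suc (suc ρ))) ≡ 2 * (a ∸ (k ∸ suc ρ)) + δℕ (k ∸ suc ρ) a
      bpart = trans (cong (λ z → (a ∸ z) + (a ∸ m)) e0) (trans (ℕP.+-comm (a ∸ suc (suc m)) (a ∸ m))
                (trans (second-difference a m) (cong (λ z → 2 * (a ∸ z) + δℕ z a) (sym e1))))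

    tent-0 : tent 0 ≡ a
    tent-0 = trans (cong (a +_) (ℕP.m≤n⇒m∸n≡0 (ℕP.<⇒≤ a<k))) (ℕP.+-identityʳ a)

    tent-k : tent k ≡ a
    tent-k = trans (cong₂ _+_ (ℕP.m≤n⇒m∸n≡0 (ℕP.<⇒≤ a<k)) (cong (a ∸_) (ℕP.n∸n≡0 k))) refl

    tent-at-0 : 2 * 1 + tent 1 + tent (k ∸ 1) ≡ 2 * tent 0 + δℕ 0 a + δℕ (k ∸ 0) a
    tent-at-0 = trans (cong₂ (λ x y → 2 + x + y) t1 tk1) (sym
        (trans (cong (λ z → 2 * z + δℕ 0 a + δℕ k a) tent-0)
        (trans (cong₂ (λ x y → 2 * a + x + y) (δℕ-≢ (λ e → ℕP.<-irrefl e 1≤a))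
        (δℕ-≢ (λ e → ℕP.<-irrefl (sym e) a<k))) (sym (fin a 1≤a)))))
      where
      a≤k-1 : a ≤ k ∸ 1
      a≤k-1 = ℕP.m+n≤o⇒m≤o∸n a (ℕP.≤-trans (ℕP.+-monoʳ-≤ a 1≤a) a+a≤k)
      t1 : tent 1 ≡ a ∸ 1
      t1 = trans (cong ((a ∸ 1) +_) (ℕP.m≤n⇒m∸n≡0 a≤k-1)) (ℕP.+-identityʳ (a ∸ 1))
      tk1 : tent (k ∸ 1) ≡ a ∸ 1
      tk1 = cong₂ _+_ (ℕP.m≤n⇒m∸n≡0 a≤k-1) (cong (a ∸_) (ℕP.m∸[m∸n]≡n (ℕP.≤-trans 1≤a (ℕP.<⇒≤ a<k))))
      fin : ∀ a → 1 ≤ a → 2 * 1 + (a ∸ 1) + (a ∸ 1) ≡ 2 * a + 0 + 0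
      fin (suc b) _ = NS.solve 1 (λ b → con 2 :* con 1 :+ b :+ b := con 2 :* (con 1 :+ b) :+ con 0 :+ con 0) refl b

    tent-balance : ∀ ρ → ρ < k → 2 * δℕ ρ 0 + tent (nextᶜ k ρ) + tent (prevᶜ k ρ) ≡ 2 * tent ρ + δℕ ρ a + δℕ (k ∸ ρ) a
    tent-balance zero lt with 1 ℕ.<? k
    ... | yes _ = tent-at-0
    ... | no n₁ = ⊥-elim (n₁ (ℕP.<-≤-trans (s≤s 1≤a) a<k))
    tent-balance (suc ρ) lt = trans (cong (λ z → z + tent ρ) nx) (trans
        (ℕP.+-comm (tent (suc (suc ρ))) (tent ρ)) (tent-interior ρ lt))
      where
      nx : tent (nextᶜ k (suc ρ)) ≡ tent (suc (suc ρ))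
      nx with suc (suc ρ) ℕ.<? k
      ... | yes _ = refl
      ... | no np = trans tent-0 (trans (sym tent-k) (cong tent (sym (ℕP.≤-antisym lt (ℕP.≮⇒≥ np)))))

  module Rungs (k₁ : ℕ) (1≤k₁ : 1 ≤ k₁) where
    open HararyIndex k₁ 1≤k₁

    rung : ℕ → ℕ
    rung i with i ℕ.<? k
    ... | yes _ = i
    ... | no _ = i ∸ k

    rung-lt : ∀ i → i < k → rung i ≡ i
    rung-lt i lt with i ℕ.<? k
    ... | yes _ = refl
    ... | no np = ⊥-elim (np lt)

    rung-ge : ∀ i → ¬ i < k → rung i ≡ i ∸ k
    rung-ge i nl with i ℕ.<? k
    ... | yes p = ⊥-elim (nl p)
    ... | no _ = refl

    nextᶜ-low : ∀ ρ → suc ρ < k → nextᶜ k ρ ≡ suc ρ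
    nextᶜ-low ρ lt with suc ρ ℕ.<? k
    ... | yes _ = refl
    ... | no np = ⊥-elim (np lt)

    nextᶜ-wrap : ∀ ρ → ¬ suc ρ < k → nextᶜ k ρ ≡ 0
    nextᶜ-wrap ρ nl with suc ρ ℕ.<? k
    ... | yes p = ⊥-elim (nl p)
    ... | no _ = refl

    ge-split : ∀ i → ¬ i < k → i ≡ k + (i ∸ k)
    ge-split i nl = sym (ℕP.m+[n∸m]≡n (ℕP.≮⇒≥ nl))

    rung<k : ∀ i → i < n → rung i < k
    rung<k i lt = aux (i ℕ.<? k)
      where
      aux : Dec (i < k) → rung i < k
      aux (yes p) = subst (_< k) (sym (rung-lt i p)) p
      aux (no np) = subst (_< k) (sym (rung-ge i np)) (ℕP.+-cancelˡ-< k (i ∸ k) k (subst (_< n) (ge-split i np) lt))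

    rung-opp : ∀ i → i < n → rung (oppᵢ i) ≡ rung i
    rung-opp i lt = aux (i ℕ.<? k)
      where
      aux : Dec (i < k) → rung (oppᵢ i) ≡ rung i
      aux (yes p) = trans (cong rung (oppᵢ-low i p)) (trans
          (rung-ge (i + k) (λ q → ℕP.<-irrefl refl (ℕP.≤-<-trans (ℕP.m≤n+m k i) q))) (trans (ℕP.m+n∸n≡m i k)
          (sym (rung-lt i p))))
      aux (no np) = trans (cong rung (oppᵢ-high i np)) (trans
          (rung-lt (i ∸ k) (ℕP.+-cancelˡ-< k (i ∸ k) k (subst (_< n) (ge-split i np) lt))) (sym (rung-ge i np)))

    rung-next : ∀ i → i < n → rung (nextᵢ i) ≡ nextᶜ k (rung i)
    rung-next i lt = aux (nextᵢ-cases i lt) (i ℕ.<? k)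
      where
      aux : (nextᵢ i ≡ suc i) ⊎ (i ≡ n₁ × nextᵢ i ≡ 0) → Dec (i < k) → rung (nextᵢ i) ≡ nextᶜ k (rung i)
      aux (inj₂ (e , e0)) _ = trans (cong rung e0) (trans (rung-lt 0 (s≤s z≤n))
          (sym (trans (cong (nextᶜ k) r) (nextᶜ-wrap k₁ (ℕP.<-irrefl refl)))))
        where
        r : rung i ≡ k₁
        r = trans (cong rung e) (trans (rung-ge n₁ (λ q → ℕP.<-irrefl refl (ℕP.<-≤-trans q (ℕP.m≤n+m k k₁)))) n₁∸k≡k₁)
      aux (inj₁ e) (yes p) = trans (cong rung e) (trans (sub (suc i ℕ.<? k)) (cong (nextᶜ k) (sym (rung-lt i p))))
        where
        sub : Dec (suc i < k) → rung (suc i) ≡ nextᶜ k i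
        sub (yes q) = trans (rung-lt (suc i) q) (sym (nextᶜ-low i q))
        sub (no nq) = trans (rung-ge (suc i) nq) (trans (si∸k≡0) (sym (nextᶜ-wrap i nq)))
          where
          si∸k≡0 : suc i ∸ k ≡ 0
          si∸k≡0 = ℕP.m≤n⇒m∸n≡0 p
      aux (inj₁ e) (no np) = trans (cong rung e) (trans (rung-ge (suc i) nsk)
          (trans (ℕP.+-∸-assoc 1 (ℕP.≮⇒≥ np)) (trans (sym (nextᶜ-low (i ∸ k) sk)) (cong (nextᶜ k) (sym (rung-ge i np))))))
        where
        nsk : ¬ suc i < k
        nsk q = np (ℕP.<-trans (ℕP.n<1+n i) q)
        sk : suc (i ∸ k) < k
        sk = ℕP.+-cancelˡ-< k (suc (i ∸ k)) k (subst (_< n)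
            (trans (ge-split (suc i) nsk) (cong (k +_) (ℕP.+-∸-assoc 1 (ℕP.≮⇒≥ np)))) (subst (_< n) e (nextᵢ<n i)))

    rung-prev : ∀ i → i < n → rung (prevᵢ i) ≡ prevᶜ k (rung i)
    rung-prev zero lt = trans (rung-ge n₁
        (λ q → ℕP.<-irrefl refl (ℕP.<-≤-trans q (ℕP.m≤n+m k k₁)))) (trans n₁∸k≡k₁ (cong (prevᶜ k) (sym (rung-lt 0 (s≤s z≤n)))))
    rung-prev (suc j) lt = aux (suc j ℕ.<? k) (j ℕ.<? k)
      where
      aux : Dec (suc j < k) → Dec (j < k) → rung j ≡ prevᶜ k (rung (suc j))
      aux (yes p) _ = trans (rung-lt j (ℕP.<-trans (ℕP.n<1+n j) p)) (cong (prevᶜ k) (sym (rung-lt (suc j) p)))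
      aux (no np) (yes q) = trans (rung-lt j q) (trans (ℕP.suc-injective (ℕP.≤-antisym q (ℕP.≮⇒≥ np)))
          (cong (prevᶜ k) (sym (trans (rung-ge (suc j) np) (ℕP.m≤n⇒m∸n≡0 q)))))
      aux (no np) (no nq) = trans (rung-ge j nq) (cong (prevᶜ k)
          (sym (trans (rung-ge (suc j) np) (ℕP.+-∸-assoc 1 (ℕP.≮⇒≥ nq)))))

module HararyGonality≤4 where

  open import Defs
  open Laplacian
  open GonalityFromCuts
  open HararyIndices
  open HararyNeighbours
  open RungCycle
  open import Data.Nat as ℕ using (ℕ; z≤n; s≤s; _∸_)
  import Data.Nat.Properties as ℕP
  open import Data.Fin as Fin using (Fin; toℕ) renaming (zero to fz)
  import Data.Fin.Properties as FinP
  open import Data.Integer as ℤ using (ℤ; +_; _+_; _-_; _*_; _≤_; +≤+)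
  import Data.Integer.Properties as ℤP
  open import Data.Integer.Solver using (module +-*-Solver)
  open +-*-Solver
  open import Data.Product using (∃; _×_)
  open import Data.Sum using (_⊎_; inj₁; inj₂)
  open import Data.Empty using (⊥)
  open import Relation.Nullary using (yes; no; Dec)
  open import Relation.Binary.PropositionalEquality
  import Data.Nat.Solver
  module NS = Data.Nat.Solver.+-*-Solver

  module Gonality≤4 (k₁ : ℕ) (1≤k₁ : 1 ℕ.≤ k₁) where
    open Harary k₁ 1≤k₁
    open Rungs k₁ 1≤k₁

    rungOf : Fin n → ℕ
    rungOf v = rung (toℕ v)

    rungOf<k : ∀ v → rungOf v ℕ.< k
    rungOf<k v = rung<k (toℕ v) (FinP.toℕ<n v)

    rungOf-next : ∀ v → rungOf (next v) ≡ nextᶜ k (rungOf v)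
    rungOf-next v = trans (cong rung (toℕ-next v)) (rung-next (toℕ v) (FinP.toℕ<n v))

    rungOf-prev : ∀ v → rungOf (prev v) ≡ prevᶜ k (rungOf v)
    rungOf-prev v = trans (cong rung (toℕ-prev v)) (rung-prev (toℕ v) (FinP.toℕ<n v))

    rungOf-opp : ∀ v → rungOf (opp v) ≡ rungOf v
    rungOf-opp v = trans (cong rung (toℕ-opp v)) (rung-opp (toℕ v) (FinP.toℕ<n v))

    rungOf≡0 : ∀ v → rungOf v ≡ 0 → v ≡ fz ⊎ v ≡ opp fz
    rungOf≡0 v ρ≡0 = by-cases (toℕ v ℕ.<? k)
      where
      by-cases : Dec (toℕ v ℕ.< k) → v ≡ fz ⊎ v ≡ opp fz
      by-cases (yes v<k) = inj₁ (FinP.toℕ-injective (trans (sym (rung-lt (toℕ v) v<k)) ρ≡0))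
      by-cases (no v≮k)  = inj₂ (FinP.toℕ-injective (trans v≡k (sym (trans (toℕ-opp fz) (oppᵢ-low 0 (s≤s z≤n))))))
        where
        v≡k : toℕ v ≡ k
        v≡k = ℕP.≤-antisym (ℕP.m∸n≡0⇒m≤n (trans (sym (rung-ge (toℕ v) v≮k)) ρ≡0)) (ℕP.≮⇒≥ v≮k)

    D : Divisor n
    D v = + (2 ℕ.* δℕ (rungOf v) 0)

    deg-D : deg D ≡ + 4
    deg-D = trans (sumFin-supported₂ D fz (opp fz) fz≢opp off-rung-0) (cong₂ _+_ (D-rung-0 fz r₀) (D-rung-0 (opp fz) rₖ))
      where
      r₀ : rungOf fz ≡ 0
      r₀ = rung-lt 0 (s≤s z≤n)
      rₖ : rungOf (opp fz) ≡ 0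
      rₖ = trans (rungOf-opp fz) r₀
      fz≢opp : fz ≢ opp fz
      fz≢opp = adjacent⇒≢ (G-opp fz)
      D-rung-0 : ∀ v → rungOf v ≡ 0 → D v ≡ + 2
      D-rung-0 v ρ≡0 = cong (λ ρ → + (2 ℕ.* δℕ ρ 0)) ρ≡0
      off-rung-0 : ∀ v → v ≢ fz → v ≢ opp fz → D v ≡ + 0
      off-rung-0 v v≢0 v≢k = cong (λ i → + (2 ℕ.* i)) (δℕ-≢ (λ ρ≡0 → cases (rungOf≡0 v ρ≡0)))
        where
        cases : v ≡ fz ⊎ v ≡ opp fz → ⊥
        cases (inj₁ v≡0) = v≢0 v≡0
        cases (inj₂ v≡k) = v≢k v≡k

    -- A script constant on rungs only sees the rung cycle: the chord inside a rung contributes nothing.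
    D-Δ-tent : ∀ a (1≤a : 1 ℕ.≤ a) (a+a≤k : a ℕ.+ a ℕ.≤ k) w →
               D w - Δ G (λ v → + Tent.tent k a 1≤a a+a≤k (rungOf v)) w ≡ + (δℕ (rungOf w) a ℕ.+ δℕ (k ∸ rungOf w) a)
    D-Δ-tent a 1≤a a+a≤k w = begin
      D w - Δ G f w
        ≡⟨ cong (_-_ (D w)) (Δ-Harary f w) ⟩
      D w - ((f w - f (next w)) + (f w - f (prev w)) + (f w - f (opp w)))
        ≡⟨ cong₂ (λ x y → D w - ((f w - + tent x) + (f w - + tent y) + (f w - + tent (rungOf (opp w)))))
                 (rungOf-next w) (rungOf-prev w) ⟩
      D w - ((+ tent ρ - + tent (nextᶜ k ρ)) + (+ tent ρ - + tent (prevᶜ k ρ)) + (+ tent ρ - + tent (rungOf (opp w))))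
        ≡⟨ cong (λ x → D w - ((+ tent ρ - + tent (nextᶜ k ρ)) + (+ tent ρ - + tent (prevᶜ k ρ)) + (+ tent ρ - + tent x))) (rungOf-opp w) ⟩
      D w - ((+ tent ρ - + tent (nextᶜ k ρ)) + (+ tent ρ - + tent (prevᶜ k ρ)) + (+ tent ρ - + tent ρ))
        ≡⟨ solve 4 (λ d x y t → d :- ((t :- x) :+ (t :- y) :+ (t :- t)) := (d :+ x :+ y) :- (t :+ t)) refl
                 (D w) (+ tent (nextᶜ k ρ)) (+ tent (prevᶜ k ρ)) (+ tent ρ) ⟩
      + (2 ℕ.* δℕ ρ 0 ℕ.+ tent (nextᶜ k ρ) ℕ.+ tent (prevᶜ k ρ)) - (+ tent ρ + + tent ρ)
        ≡⟨ cong (λ x → + x - (+ tent ρ + + tent ρ)) (trans (tent-balance ρ (rungOf<k w)) (regroup (tent ρ) (δℕ ρ a) (δℕ (k ∸ ρ) a))) ⟩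
      + ((tent ρ ℕ.+ tent ρ) ℕ.+ (δℕ ρ a ℕ.+ δℕ (k ∸ ρ) a)) - (+ tent ρ + + tent ρ)
        ≡⟨ solve 2 (λ p q → (p :+ q) :- p := q) refl (+ tent ρ + + tent ρ) (+ (δℕ ρ a ℕ.+ δℕ (k ∸ ρ) a)) ⟩
      + (δℕ ρ a ℕ.+ δℕ (k ∸ ρ) a)
        ∎
      where
      open ≡-Reasoning
      open Tent k a 1≤a a+a≤k
      ρ = rungOf w
      f : Fin n → ℤ
      f v = + tent (rungOf v)
      regroup : ∀ t i j → 2 ℕ.* t ℕ.+ i ℕ.+ j ≡ (t ℕ.+ t) ℕ.+ (i ℕ.+ j)
      regroup = NS.solve 3 (λ t i j → NS.con 2 NS.:* t NS.:+ i NS.:+ j NS.:= (t NS.:+ t) NS.:+ (i NS.:+ j)) refl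

    tent-witness : ∀ q a (1≤a : 1 ℕ.≤ a) (a+a≤k : a ℕ.+ a ℕ.≤ k) → rungOf q ≡ a ⊎ k ∸ rungOf q ≡ a →
                   ∃ λ E → Effective E × Equiv G (minusPt D q) E
    tent-witness q a 1≤a a+a≤k hit =
      dominating-script⇒witness undirected loopless fz D q (λ v → + Tent.tent k a 1≤a a+a≤k (rungOf v)) (λ w →
        subst (χ q w ≤_) (sym (D-Δ-tent a 1≤a a+a≤k w)) (χ≤ w))
      where
      δℕ-hit : rungOf q ≡ a ⊎ k ∸ rungOf q ≡ a → 1 ℕ.≤ δℕ (rungOf q) a ℕ.+ δℕ (k ∸ rungOf q) a
      δℕ-hit (inj₁ r≡a)   = subst (λ i → 1 ℕ.≤ i ℕ.+ δℕ (k ∸ rungOf q) a) (sym (trans (cong (λ ρ → δℕ ρ a) r≡a) (δℕ-refl a))) (s≤s z≤n)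
      δℕ-hit (inj₂ k-r≡a) = subst (λ i → 1 ℕ.≤ δℕ (rungOf q) a ℕ.+ i) (sym (trans (cong (λ ρ → δℕ ρ a) k-r≡a) (δℕ-refl a)))
                              (ℕP.m≤n+m 1 (δℕ (rungOf q) a))
      χ≤ : ∀ w → χ q w ≤ + (δℕ (rungOf w) a ℕ.+ δℕ (k ∸ rungOf w) a)
      χ≤ w with q FinP.≟ w
      ... | yes refl = +≤+ (δℕ-hit hit)
      ... | no _     = +≤+ z≤n

    positiveRank-D : PositiveRank G D
    positiveRank-D q with rungOf q ℕ.+ rungOf q ℕ.≤? k | rungOf q ℕ.≟ 0
    ... | _        | yes r≡0 = dominating-script⇒witness undirected loopless fz D q (λ _ → + 0) (λ w →
          subst (χ q w ≤_) (sym (trans (cong (_-_ (D w)) (Δ-const G (+ 0) w)) (ℤP.+-identityʳ (D w)))) (χ≤D w))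
      where
      χ≤D : ∀ w → χ q w ≤ D w
      χ≤D w with q FinP.≟ w
      ... | yes refl = subst (λ ρ → + 1 ≤ + (2 ℕ.* δℕ ρ 0)) (sym r≡0) (+≤+ (s≤s z≤n))
      ... | no _     = +≤+ z≤n
    ... | yes r+r≤k | no r≢0 = tent-witness q (rungOf q) (ℕP.n≢0⇒n>0 r≢0) r+r≤k (inj₁ refl)
    ... | no r+r≰k  | _      = tent-witness q (k ∸ rungOf q) (ℕP.m<n⇒0<n∸m (rungOf<k q)) k-r+k-r≤k (inj₂ refl)
      where
      r = rungOf q
      r+[k-r]≡k : r ℕ.+ (k ∸ r) ≡ k
      r+[k-r]≡k = ℕP.m+[n∸m]≡n (ℕP.<⇒≤ (rungOf<k q))
      k-r<r : k ∸ r ℕ.< r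
      k-r<r = ℕP.+-cancelˡ-< r (k ∸ r) r (subst (ℕ._< r ℕ.+ r) (sym r+[k-r]≡k) (ℕP.≰⇒> r+r≰k))
      k-r+k-r≤k : (k ∸ r) ℕ.+ (k ∸ r) ℕ.≤ k
      k-r+k-r≤k = subst ((k ∸ r) ℕ.+ (k ∸ r) ℕ.≤_) r+[k-r]≡k (ℕP.+-monoˡ-≤ (k ∸ r) (ℕP.<⇒≤ k-r<r))

module SmallHarary where

  open import Defs
  open Laplacian
  open GonalityFromCuts
  open HararyNeighbours
  open HararyEdgeCuts
  open HararyGonality≥4
  open HararyGonality≤4
  open import Data.Nat as ℕ using (ℕ; _*_; _≤_; z≤n; s≤s)
  import Data.Nat.Properties as ℕP
  open import Data.Fin using (Fin) renaming (zero to fz; suc to fs)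
  import Data.Fin.Properties as FinP
  open import Data.Integer as ℤ using (ℤ; +_; _-_)
  open import Data.Product using (∃; _×_; _,_)
  open import Data.Empty using ()
  open import Data.Unit using (tt)
  open import Relation.Nullary.Decidable using (True; toWitness)
  open import Relation.Binary.PropositionalEquality
  open import Function using (_∘_)

  module ThreeChips (k₁ : ℕ) (1≤k₁ : 1 ≤ k₁) where
    open Harary k₁ 1≤k₁

    D₃ : Divisor n
    D₃ v = + 3 ℤ.* χ fz v

    checked-script : ∀ q (f : Fin n → ℤ) → True (FinP.all? (λ w → χ q w ℤ.≤? D₃ w - Δ G f w)) →
                     ∃ λ E → Effective E × Equiv G (minusPt D₃ q) E
    checked-script q f ok = dominating-script⇒witness undirected loopless fz D₃ q f (toWitness ok)

    gonality≥3 : ∀ D → PositiveRank G D → + 3 ℤ.≤ deg D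
    gonality≥3 D rank = rep-deg≥ undirected 3 (ℕP.≤-trans (s≤s (s≤s (s≤s z≤n))) (4≤n)) (HararyCuts.cut≥3 k₁ 1≤k₁)
                          (positiveRank⇒rep undirected loopless fz rank)

    gonality≡3 : PositiveRank G D₃ → IsGonality G (+ 3)
    gonality≡3 rank = (D₃ , rank , deg-D₃) , gonality≥3
      where
      deg-D₃ : deg D₃ ≡ + 3
      deg-D₃ = sumFin-supported₁ D₃ fz (λ v v≢fz → cong (+ 3 ℤ.*_) (χ-diff (v≢fz ∘ sym)))

  gonality-H₃,₄ : IsGonality (HararyAdj 4) (+ 3)
  gonality-H₃,₄ = gonality≡3 λ
    { fz                → checked-script fz (λ _ → + 0) tt
    ; (fs fz)           → checked-script (fs fz) (χ fz) tt
    ; (fs (fs fz))      → checked-script (fs (fs fz)) (χ fz) tt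
    ; (fs (fs (fs fz))) → checked-script (fs (fs (fs fz))) (χ fz) tt
    }
    where open ThreeChips 1 (s≤s z≤n)

  -- 2 and 4 lie in the same part of H_{3,6} = K_{3,3} as 0: firing 0 and borrowing at q moves all three chips onto q.
  gonality-H₃,₆ : IsGonality (HararyAdj 6) (+ 3)
  gonality-H₃,₆ = gonality≡3 λ
    { fz                          → checked-script fz (λ _ → + 0) tt
    ; (fs fz)                     → checked-script (fs fz) (χ fz) tt
    ; (fs (fs fz))                → checked-script (fs (fs fz)) (λ u → χ fz u - χ (fs (fs fz)) u) tt
    ; (fs (fs (fs fz)))           → checked-script (fs (fs (fs fz))) (χ fz) tt
    ; (fs (fs (fs (fs fz))))      → checked-script (fs (fs (fs (fs fz)))) (λ u → χ fz u - χ (fs (fs (fs (fs fz)))) u) tt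
    ; (fs (fs (fs (fs (fs fz))))) → checked-script (fs (fs (fs (fs (fs fz))))) (χ fz) tt
    }
    where open ThreeChips 2 (s≤s z≤n)

open import Defs
open GonalityFromCuts
open HararyNeighbours
open HararyGonality≥4
open HararyGonality≤4
open SmallHarary
open import Data.Nat as ℕ using (ℕ; zero; suc; _*_; _+_; _≤_; z≤n; s≤s)
import Data.Nat.Properties as ℕP
open import Data.Fin using () renaming (zero to fz)
open import Data.Integer using (+_)
open import Data.Product using (_×_; _,_)
open import Data.Empty using (⊥; ⊥-elim)
open import Relation.Binary.PropositionalEquality

gonality-H₃,₂ₖ : ∀ k₁ → 3 ≤ k₁ → IsGonality (HararyAdj (suc k₁ + suc k₁)) (+ 4)
gonality-H₃,₂ₖ k₁ 3≤k₁ = (D , positiveRank-D , deg-D) , λ _ rank → rep-deg≥4 (positiveRank⇒rep undirected loopless fz rank)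
  where
  1≤k₁ = ℕP.≤-trans (s≤s z≤n) 3≤k₁
  open Harary k₁ 1≤k₁
  open Gonality≤4 k₁ 1≤k₁
  open Gonality≥4 k₁ 1≤k₁ 3≤k₁

Claim : ℕ → Set
Claim n = (n ≤ 6 → IsGonality (HararyAdj n) (+ 3)) × (8 ≤ n → IsGonality (HararyAdj n) (+ 4))

claim : ∀ j → Claim (suc (suc j) + suc (suc j))
claim 0 = (λ _ → gonality-H₃,₄) , λ { (s≤s (s≤s (s≤s (s≤s ())))) }
claim 1 = (λ _ → gonality-H₃,₆) , λ { (s≤s (s≤s (s≤s (s≤s (s≤s (s≤s ())))))) }
claim (suc (suc i)) = (λ n≤6 → ⊥-elim (8≰6 n≤6)) , λ _ → gonality-H₃,₂ₖ (3 + i) (s≤s (s≤s (s≤s z≤n)))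
  where
  8≰6 : suc (3 + i) + suc (3 + i) ≤ 6 → ⊥
  8≰6 n≤6 with ℕP.≤-trans (ℕP.+-mono-≤ (ℕP.m≤m+n 4 i) (ℕP.m≤m+n 4 i)) n≤6
  ... | s≤s (s≤s (s≤s (s≤s (s≤s (s≤s ())))))

theorem3p5 : (n k : ℕ) → n ≡ 2 * k → 4 ≤ n →
    (n ≤ 6 → IsGonality (HararyAdj n) (+ 3)) × (8 ≤ n → IsGonality (HararyAdj n) (+ 4))
theorem3p5 n zero          refl ()
theorem3p5 n (suc zero)    refl (s≤s (s≤s ()))
theorem3p5 n (suc (suc j)) n≡2k _ =
  subst Claim (sym (trans n≡2k (cong (_+_ (suc (suc j))) (ℕP.+-identityʳ (suc (suc j)))))) (claim j)
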